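{- Let $\Lambda\subseteq\mathbb Z^n$ be a lattice generated by $d$ vectors such that the projection $\pi:\mathbb Z^n\to\mathbb Z^d$ onto the first $d$ components is injective on $\Lambda$, and let $\mathcal S_\Lambda\subseteq S_n$ be a group of permutations with $\sigma(v)\in\Lambda$ for all $v\in\Lambda$, $\sigma\in\mathcal S_\Lambda$. For $v\in\Lambda$ let $\|v\|:=\|\pi(v)\|_1$, and for $T\subseteq\Lambda$ let $\|T\|:=\min\{\|v\|:v\in T\}$. Let $\bar F\subseteq\Lambda$ be such that $\pi(\bar F)$ is the set of $\sqsubseteq$-minimal nonzero vectors of $\pi(\Lambda)$. Consider the following algorithm, in which throughout $G$ denotes $\operatorname{orb}(G^{\mathrm{sym}}):=\bigcup_{v\in G^{\mathrm{sym}}}\operatorname{orb}(v)$: set $G^{\mathrm{sym}}:=\operatorname{rep}(\bar F)$ and $C^{\mathrm{sym}}:=\operatorname{rep}(\{f+g:f,g\in G\})$; while $C^{\mathrm{sym}}\neq\emptyset$: choose $s\in C^{\mathrm{sym}}$ with smallest value of $\|\operatorname{orb}(s)\|$, remove it from $C^{\mathrm{sym}}$, compute $f:=\mathrm{nF}(s,G)$; if $f\neq0$, add $f$ to $G^{\mathrm{sym}}$ and add to $C^{\mathrm{sym}}$ all vectors $f+g'$ with $g'\in\operatorname{orb}(g)$, $g\in G$ (with $G$ the updated set). Finally return $G=\operatorname{orb}(G^{\mathrm{sym}})$. Then this algorithm always terminates and returns the set $G=\mathcal G(\Lambda)$.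
   Context: For $u,v\in\mathbb Z^m$, write $u\sqsubseteq v$ if $u^{(j)}v^{(j)}\ge 0$ and $|u^{(j)}|\le|v^{(j)}|$ for all $j$. The Graver basis $\mathcal G(\Lambda)$ is the set of all $\sqsubseteq$-minimal nonzero elements of $\Lambda$. For $\sigma\in S_n$, $\sigma(v):=(v^{(\sigma(1))},\dots,v^{(\sigma(n))})$, $\operatorname{orb}(v):=\{\sigma(v):\sigma\in\mathcal S_\Lambda\}$, and for $H\subseteq\Lambda$, $\operatorname{rep}(H)$ denotes a set of representatives of the orbits under $\mathcal S_\Lambda$ of the elements of $H$. Here the normal form is $\mathrm{nF}(s,G):=0$ if there is some $g\in G$ with $g\sqsubseteq s$, and $\mathrm{nF}(s,G):=s$ otherwise. -}

module Defs where

open import Data.Nat as ℕ using (ℕ; _⊓_)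
open import Data.Integer as ℤ using (ℤ; ∣_∣; 0ℤ)
open import Data.Fin using (Fin; inject≤)
open import Data.Vec as V using (Vec; []; _∷_; tabulate; lookup; zipWith; replicate)
open import Data.List as L using (List; []; _∷_; _++_; concatMap)
open import Data.List.Membership.Propositional using (_∈_)
open import Data.List.Relation.Unary.All using (All)
open import Data.List.Relation.Unary.AllPairs using (AllPairs)
open import Data.Fin.Permutation using (Permutation′; _⟨$⟩ʳ_; _∘ₚ_; flip; id)
open import Data.Product using (Σ; ∃; _×_; _,_)
open import Relation.Nullary using (¬_)
open import Relation.Binary.PropositionalEquality using (_≡_; _≢_)

_⊑_ : ∀ {m} → Vec ℤ m → Vec ℤ m → Set
u ⊑ v = ∀ j → (0ℤ ℤ.≤ lookup u j ℤ.* lookup v j) × (∣ lookup u j ∣ ℕ.≤ ∣ lookup v j ∣)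

zeroV : ∀ {m} → Vec ℤ m
zeroV = replicate _ 0ℤ

_+ᵥ_ : ∀ {m} → Vec ℤ m → Vec ℤ m → Vec ℤ m
_+ᵥ_ = zipWith ℤ._+_

_·ᵥ_ : ∀ {m} → ℤ → Vec ℤ m → Vec ℤ m
c ·ᵥ v = V.map (c ℤ.*_) v

lincomb : ∀ {n d} → Vec (Vec ℤ n) d → Vec ℤ d → Vec ℤ n
lincomb [] [] = zeroV
lincomb (b ∷ bs) (c ∷ cs) = (c ·ᵥ b) +ᵥ lincomb bs cs

InLattice : ∀ {n d} → Vec (Vec ℤ n) d → Vec ℤ n → Set
InLattice {d = d} B v = Σ (Vec ℤ d) λ c → v ≡ lincomb B c

proj : ∀ {n d} → d ℕ.≤ n → Vec ℤ n → Vec ℤ d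
proj d≤n v = tabulate λ j → lookup v (inject≤ j d≤n)

InProjLattice : ∀ {n d} → d ℕ.≤ n → Vec (Vec ℤ n) d → Vec ℤ d → Set
InProjLattice {n} d≤n B u = Σ (Vec ℤ n) λ v → InLattice B v × proj d≤n v ≡ u

MinimalNonzero : ∀ {m} → (Vec ℤ m → Set) → Vec ℤ m → Set
MinimalNonzero P u = P u × u ≢ zeroV × (∀ w → P w → w ≢ zeroV → w ⊑ u → w ≡ u)

Graver : ∀ {n d} → Vec (Vec ℤ n) d → Vec ℤ n → Set
Graver B = MinimalNonzero (InLattice B)

act : ∀ {n} → Permutation′ n → Vec ℤ n → Vec ℤ n
act σ v = tabulate λ i → lookup v (σ ⟨$⟩ʳ i)

_≈ₚ_ : ∀ {n} → Permutation′ n → Permutation′ n → Set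
σ ≈ₚ τ = ∀ i → σ ⟨$⟩ʳ i ≡ τ ⟨$⟩ʳ i

IsPermGroup : ∀ {n} → List (Permutation′ n) → Set
IsPermGroup S =
  (Σ _ λ ρ → ρ ∈ S × ρ ≈ₚ id) ×
  (∀ σ τ → σ ∈ S → τ ∈ S → Σ _ λ ρ → ρ ∈ S × ρ ≈ₚ (σ ∘ₚ τ)) ×
  (∀ σ → σ ∈ S → Σ _ λ ρ → ρ ∈ S × ρ ≈ₚ flip σ)

orb : ∀ {n} → List (Permutation′ n) → Vec ℤ n → List (Vec ℤ n)
orb S v = L.map (λ σ → act σ v) S

orbAll : ∀ {n} → List (Permutation′ n) → List (Vec ℤ n) → List (Vec ℤ n)
orbAll S Gs = concatMap (orb S) Gs

InOrb : ∀ {n} → List (Permutation′ n) → Vec ℤ n → Vec ℤ n → Set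
InOrb S v w = Σ _ λ σ → σ ∈ S × w ≡ act σ v

IsRep : ∀ {n} → List (Permutation′ n) → (Vec ℤ n → Set) → List (Vec ℤ n) → Set
IsRep S H R =
  All H R ×
  (∀ v → H v → Σ _ λ r → r ∈ R × InOrb S r v) ×
  AllPairs (λ r r′ → ¬ InOrb S r r′) R

norm : ∀ {n d} → d ℕ.≤ n → Vec ℤ n → ℕ
norm d≤n v = V.sum (V.map ∣_∣ (proj d≤n v))

-- ‖orb(v)‖ := min { ‖w‖ : w ∈ orb(v) }  (v itself is in orb(v) since id ∈ S)
orbNorm : ∀ {n d} → d ℕ.≤ n → List (Permutation′ n) → Vec ℤ n → ℕ
orbNorm d≤n S v = L.foldr _⊓_ (norm d≤n v) (L.map (λ σ → norm d≤n (act σ v)) S)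

NF : ∀ {n} → List (Vec ℤ n) → Vec ℤ n → Vec ℤ n → Set
NF G s f =
  ((Σ _ λ g → g ∈ G × g ⊑ s) × f ≡ zeroV) ⊎′
  ((¬ (Σ _ λ g → g ∈ G × g ⊑ s)) × f ≡ s)
  where
  open import Data.Sum using () renaming (_⊎_ to _⊎′_)

record State (n : ℕ) : Set where
  constructor ⟨_,_⟩
  field
    Gsym : List (Vec ℤ n)
    Csym : List (Vec ℤ n)
open State public

Init : ∀ {n} → List (Permutation′ n) → (Vec ℤ n → Set) → State n → Set
Init S Fbar st =
  IsRep S Fbar (Gsym st) ×
  IsRep S (λ w → Σ _ λ f → Σ _ λ g → f ∈ orbAll S (Gsym st) × g ∈ orbAll S (Gsym st) × w ≡ f +ᵥ g) (Csym st)

data Step {n d} (d≤n : d ℕ.≤ n) (S : List (Permutation′ n)) : State n → State n → Set where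
  drop : ∀ Gs C₁ s C₂ f →
    (∀ t → t ∈ (C₁ ++ s ∷ C₂) → orbNorm d≤n S s ℕ.≤ orbNorm d≤n S t) →
    NF (orbAll S Gs) s f → f ≡ zeroV →
    Step d≤n S ⟨ Gs , C₁ ++ s ∷ C₂ ⟩ ⟨ Gs , C₁ ++ C₂ ⟩
  add : ∀ Gs C₁ s C₂ f →
    (∀ t → t ∈ (C₁ ++ s ∷ C₂) → orbNorm d≤n S s ℕ.≤ orbNorm d≤n S t) →
    NF (orbAll S Gs) s f → f ≢ zeroV →
    Step d≤n S ⟨ Gs , C₁ ++ s ∷ C₂ ⟩
               ⟨ Gs ++ f ∷ [] , C₁ ++ C₂ ++ L.map (f +ᵥ_) (orbAll S (Gs ++ f ∷ [])) ⟩

{-# OPTIONS --safe #-}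
-- Termination: every vector added to G^sym lies above no element of G, and ⊑ on ℤⁿ is almost full
-- (a constructive Dickson lemma), so only finitely many vectors are added; in between, C^sym shrinks.
--
-- Correctness: throughout, G consists of Graver elements and contains F̄, and every sum f + g of
-- elements of G is zero, reducible by G, or in the orbit of a pending candidate. Candidates are taken
-- in order of orbit norm, so all sums of norm below the current ‖orb(s)‖ are zero or reducible. A
-- completion argument then writes every lattice vector w of norm below ‖orb(s)‖ as a conformal sum of
-- elements of G: start from some f ∈ F̄ with π(f) ⊑ π(w), write w = f + (w - f), and trade summands of
-- the two parts that are not sign-compatible until the parts are. Hence an irreducible candidate s is
-- a Graver element (a proper conformal piece of s, moved to norm below ‖orb(s)‖, would be reducible),
-- and once C^sym is empty each Graver element is reducible by, hence equal to, an element of G.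
-- The completion argument chooses ⊑-minimal elements, so it lives in the double-negation monad;
-- decidability of ⊑ and of list membership removes the double negations.
module Submission where

open import Defs
open import Data.Nat as ℕ using (ℕ; zero; suc; _<_; _≤_; z≤n; s≤s)
import Data.Nat.Properties as ℕP
open import Data.Nat.Induction using (<-wellFounded)
import Data.Nat.Tactic.RingSolver as ℕSolver
open import Data.Integer as ℤ using (ℤ; +_; -[1+_]; +0; +[1+_]; 0ℤ; ∣_∣; +≤+)
import Data.Integer.Properties as ℤP
open import Data.Integer.Tactic.RingSolver using (solve-∀)
open import Algebra.Properties.CommutativeSemigroup ℕP.+-commutativeSemigroup using ()
  renaming (interchange to +-interchange; x∙yz≈y∙xz to x+[y+z]≡y+[x+z])
open import Algebra.Properties.CommutativeSemigroup ℤP.+-commutativeSemigroup using ()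
  renaming (interchange to +ℤ-interchange)
open import Data.Sign as Sign using (Sign)
open import Data.Fin as Fin using (Fin; inject≤)
import Data.Fin.Properties as FinP
open import Data.Fin.Permutation using (Permutation′; _⟨$⟩ʳ_; _∘ₚ_; flip; inverseʳ; inverseˡ) renaming (id to idₚ)
open import Data.Vec as V using (Vec; []; _∷_; lookup; zipWith; replicate; tabulate)
import Data.Vec.Properties as VP
open import Data.Vec.Relation.Binary.Pointwise.Inductive as Pointwise using (Pointwise; []; _∷_)
open import Data.List as L using (List; []; _∷_; _++_)
open import Data.List.Properties using (length-++-sucʳ; ++-assoc)
open import Data.List.Membership.Propositional using (_∈_; find; lose)
open import Data.List.Membership.Propositional.Properties
  using (∈-map⁺; ∈-map⁻; ∈-++⁺ˡ; ∈-++⁺ʳ; ∈-++⁻; ∈-concatMap⁺; ∈-concatMap⁻; ∈-∃++; foldr-selective)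
open import Data.List.Relation.Unary.Any as Any using (here; there)
open import Data.List.Relation.Unary.All as All using (All; []; _∷_)
import Data.List.Relation.Unary.All.Properties as AllP
open import Data.List.Relation.Binary.Permutation.Propositional using (↭-sym)
open import Data.List.Relation.Binary.Permutation.Propositional.Properties using (shift; ∈-resp-↭)
open import Data.List.Extrema.Nat using (argmin; argmin-sel; f[argmin]≤f[⊤]; f[argmin]≤f[xs])
open import Data.Empty using (⊥; ⊥-elim)
open import Data.Unit using (⊤; tt)
open import Data.Product using (Σ; ∃; ∃₂; _×_; _,_; proj₁; proj₂)
open import Data.Product.Relation.Binary.Lex.Strict using (×-Lex; ×-wellFounded)
open import Data.Sum as Sum using (_⊎_; inj₁; inj₂; [_,_]′; map₁; map₂)
open import Function using (_∘_; id)
open import Function.Bundles using (_⇔_; Equivalence; mk⇔)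
open import Level using (0ℓ)
open import Effect.Monad using (RawMonad)
open import Relation.Binary.Core using (Rel; _⇒_)
open import Relation.Binary.PropositionalEquality
  using (_≡_; _≢_; refl; sym; trans; cong; cong₂; subst; subst₂; module ≡-Reasoning)
open import Relation.Binary.Construct.On as On using ()
open import Relation.Binary.Construct.Closure.ReflexiveTransitive using (Star; ε; _◅_)
open import Relation.Nullary using (¬_; Dec; yes; no)
import Relation.Nullary.Decidable as Dec
open import Relation.Nullary.Decidable using (_×-dec_; decidable-stable; ¬¬-excluded-middle)
open import Relation.Nullary.Negation using (¬¬-Monad)
open import Induction.WellFounded using (Acc; acc; WellFounded; module Subrelation)

private
  variable
    m : ℕ

-- Almost-full relations

module AlmostFull where

  -- The inductive almost-full relations of Vytiniotis, Coquand and Wahlstedt ("Stop when you are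
  -- almost-full", ITP 2012). Their proof of the intersection theorem af-∩ is followed; its induction
  -- only goes through for the generalisations af-⊕-nullary, af-⊕-unary and af-∩-unary.
  data AlmostFull {X : Set} (R : Rel X 0ℓ) : Set where
    now   : (∀ x y → R x y) → AlmostFull R
    later : (∀ x → AlmostFull (λ y z → R y z ⊎ R x y)) → AlmostFull R

  private
    distrib : {A B C : Set} → A ⊎ B → A ⊎ C → A ⊎ B × C
    distrib (inj₁ a) _        = inj₁ a
    distrib (inj₂ _) (inj₁ a) = inj₁ a
    distrib (inj₂ b) (inj₂ c) = inj₂ (b , c)

    distribʳ : {A B C : Set} → A ⊎ C → B ⊎ C → A × B ⊎ C
    distribʳ p q = Sum.swap (distrib (Sum.swap p) (Sum.swap q))

  module _ {X : Set} where

    af-mono : {R T : Rel X 0ℓ} → R ⇒ T → AlmostFull R → AlmostFull T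
    af-mono R⇒T (now r)   = now λ x y → R⇒T (r x y)
    af-mono R⇒T (later f) = later λ x → af-mono (Sum.map R⇒T R⇒T) (f x)

    private
      ⊕-at : {P Z : Rel X 0ℓ} {C : X → Set} → P ⇒ (λ y z → Z y z ⊎ C y) →
        ∀ x → (λ y z → P y z ⊎ P x y) ⇒ (λ y z → Z y z ⊎ (C y ⊎ Z x y) ⊎ C x)
      ⊕-at h x = [ map₂ (inj₁ ∘ inj₁) ∘ h , inj₂ ∘ map₁ inj₂ ∘ h ]′

    af-⊕-nullary : {R₀ S₀ : Rel X 0ℓ} (Z : Rel X 0ℓ) {N M : Set} → AlmostFull R₀ → AlmostFull S₀ →
      R₀ ⇒ (λ y z → Z y z ⊎ N) → S₀ ⇒ (λ y z → Z y z ⊎ M) → AlmostFull (λ y z → Z y z ⊎ N × M)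
    af-⊕-nullary Z (now r)   s hr hs = af-mono (λ p → distrib (hr (r _ _)) (hs p)) s
    af-⊕-nullary Z (later f) s hr hs = later λ x →
      af-mono [ Sum.map inj₁ inj₁ , inj₁ ∘ inj₂ ]′
        (af-⊕-nullary (λ y z → Z y z ⊎ Z x y) (f x) s [ map₁ inj₁ ∘ hr , map₁ inj₂ ∘ hr ]′ (map₁ inj₁ ∘ hs))

    af-⊕-unary : {R₀ S₀ : Rel X 0ℓ} (Z : Rel X 0ℓ) {A B : X → Set} → AlmostFull R₀ → AlmostFull S₀ →
      R₀ ⇒ (λ y z → Z y z ⊎ A y) → S₀ ⇒ (λ y z → Z y z ⊎ B y) → AlmostFull (λ y z → Z y z ⊎ A y × B y)
    af-⊕-unary Z (now r)       s         hr hs = af-mono (λ p → distrib (hr (r _ _)) (hs p)) s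
    af-⊕-unary Z r@(later _)   (now s)   hr hs = af-mono (λ p → distrib (hr p) (hs (s _ _))) r
    af-⊕-unary {R₀} {S₀} Z {A} {B} (later f) (later h) hr hs = later λ x →
      af-mono (regroup x)
        (af-⊕-nullary (W x)
          (af-mono (left x)  (af-⊕-unary Z (f x) (later h) (⊕-at {R₀} hr x) (map₂ inj₁ ∘ hs)))
          (af-mono (right x) (af-⊕-unary Z (later f) (h x) (map₂ inj₁ ∘ hr) (⊕-at {S₀} hs x)))
          id id)
      where
      W : X → Rel X 0ℓ
      W x y z = (Z y z ⊎ A y × B y) ⊎ Z x y
      left : ∀ x → (λ y z → Z y z ⊎ ((A y ⊎ Z x y) ⊎ A x) × (B y ⊎ Z x y)) ⇒ (λ y z → W x y z ⊎ A x)
      left x (inj₁ a)                             = inj₁ (inj₁ (inj₁ a))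
      left x (inj₂ (inj₂ ax , _))                 = inj₂ ax
      left x (inj₂ (inj₁ (inj₂ zx) , _))          = inj₁ (inj₂ zx)
      left x (inj₂ (inj₁ (inj₁ _) , inj₂ zx))     = inj₁ (inj₂ zx)
      left x (inj₂ (inj₁ (inj₁ ay) , inj₁ by))    = inj₁ (inj₁ (inj₂ (ay , by)))
      right : ∀ x → (λ y z → Z y z ⊎ (A y ⊎ Z x y) × ((B y ⊎ Z x y) ⊎ B x)) ⇒ (λ y z → W x y z ⊎ B x)
      right x (inj₁ a)                            = inj₁ (inj₁ (inj₁ a))
      right x (inj₂ (_ , inj₂ bx))                = inj₂ bx
      right x (inj₂ (_ , inj₁ (inj₂ zx)))         = inj₁ (inj₂ zx)
      right x (inj₂ (inj₂ zx , inj₁ (inj₁ _)))    = inj₁ (inj₂ zx)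
      right x (inj₂ (inj₁ ay , inj₁ (inj₁ by)))   = inj₁ (inj₁ (inj₂ (ay , by)))
      regroup : ∀ x → (λ y z → W x y z ⊎ A x × B x) ⇒
        (λ y z → (Z y z ⊎ A y × B y) ⊎ (Z x y ⊎ A x × B x))
      regroup x = [ map₂ inj₁ , inj₂ ∘ inj₂ ]′

    af-∩-unary : {R₀ S₀ : Rel X 0ℓ} (R T : Rel X 0ℓ) {U : X → Set} → AlmostFull R₀ → AlmostFull S₀ →
      R₀ ⇒ (λ y z → R y z ⊎ U y) → S₀ ⇒ (λ y z → T y z ⊎ U y) → AlmostFull (λ y z → R y z × T y z ⊎ U y)
    af-∩-unary R T (now r)     s         hr hs = af-mono (λ p → distribʳ (hr (r _ _)) (hs p)) s
    af-∩-unary R T r@(later _) (now s)   hr hs = af-mono (λ p → distribʳ (hr p) (hs (s _ _))) r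
    af-∩-unary {R₀} {S₀} R T {U} (later f) (later h) hr hs = later λ x →
      af-mono (regroup x)
        (af-⊕-unary (λ y z → R y z × T y z) {λ y → (U y ⊎ R x y) ⊎ U x} {λ y → (U y ⊎ T x y) ⊎ U x}
          (af-∩-unary R T (f x) (later h) (⊕-at {R₀} hr x) (map₂ (inj₁ ∘ inj₁) ∘ hs))
          (af-∩-unary R T (later f) (h x) (map₂ (inj₁ ∘ inj₁) ∘ hr) (⊕-at {S₀} hs x))
          id id)
      where
      regroup : ∀ x → (λ y z → R y z × T y z ⊎ ((U y ⊎ R x y) ⊎ U x) × ((U y ⊎ T x y) ⊎ U x)) ⇒
        (λ y z → (R y z × T y z ⊎ U y) ⊎ (R x y × T x y ⊎ U x))
      regroup x (inj₁ rt)                              = inj₁ (inj₁ rt)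
      regroup x (inj₂ (inj₁ (inj₁ u) , _))             = inj₁ (inj₂ u)
      regroup x (inj₂ (inj₂ u , _))                    = inj₂ (inj₂ u)
      regroup x (inj₂ (inj₁ (inj₂ _) , inj₁ (inj₁ u))) = inj₁ (inj₂ u)
      regroup x (inj₂ (inj₁ (inj₂ _) , inj₂ u))        = inj₂ (inj₂ u)
      regroup x (inj₂ (inj₁ (inj₂ r) , inj₁ (inj₂ t))) = inj₂ (inj₁ (r , t))

    af-∩ : {R T : Rel X 0ℓ} → AlmostFull R → AlmostFull T → AlmostFull (λ y z → R y z × T y z)
    af-∩ {R} {T} r t = af-mono [ id , ⊥-elim ]′ (af-∩-unary R T {U = λ _ → ⊥} r t inj₁ inj₁)

  af-comap : {X Y : Set} {R : Rel Y 0ℓ} (f : X → Y) → AlmostFull R → AlmostFull (λ a b → R (f a) (f b))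
  af-comap f (now r)   = now λ x y → r (f x) (f y)
  af-comap f (later g) = later λ x → af-comap f (g (f x))

open AlmostFull

foldr-⊓-≤ : ∀ b {x} {xs : List ℕ} → x ∈ xs → L.foldr ℕ._⊓_ b xs ≤ x
foldr-⊓-≤ b (here refl)  = ℕP.m⊓n≤m _ _
foldr-⊓-≤ b (there x∈xs) = ℕP.≤-trans (ℕP.m⊓n≤n _ _) (foldr-⊓-≤ b x∈xs)

module _ {A : Set} where

  ∈-middle⁻ : ∀ (xs : List A) {y ys x} → x ∈ xs ++ y ∷ ys → x ≡ y ⊎ x ∈ xs ++ ys
  ∈-middle⁻ xs {y} {ys} x∈ with ∈-resp-↭ (shift y xs ys) x∈
  ... | here x≡y = inj₁ x≡y
  ... | there x∈′ = inj₂ x∈′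

  ∈-middle⁺ : ∀ (xs : List A) {y ys x} → x ∈ xs ++ ys → x ∈ xs ++ y ∷ ys
  ∈-middle⁺ xs {y} {ys} x∈ = ∈-resp-↭ (↭-sym (shift y xs ys)) (there x∈)

  ∈-++-++⁻ : ∀ (xs ys : List A) {zs x} → x ∈ xs ++ ys ++ zs → x ∈ xs ++ ys ⊎ x ∈ zs
  ∈-++-++⁻ xs ys {zs} x∈ = ∈-++⁻ (xs ++ ys) (subst (_ ∈_) (sym (++-assoc xs ys zs)) x∈)

  ∈-++-++⁺ˡ : ∀ (xs ys : List A) {zs x} → x ∈ xs ++ ys → x ∈ xs ++ ys ++ zs
  ∈-++-++⁺ˡ xs ys {zs} x∈ = subst (_ ∈_) (++-assoc xs ys zs) (∈-++⁺ˡ x∈)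

minimal-split : ∀ {A : Set} (f : A → ℕ) (C : List A) → C ≢ [] →
  ∃ λ C₁ → ∃ λ s → ∃ λ C₂ → C ≡ C₁ ++ s ∷ C₂ × (∀ t → t ∈ C → f s ≤ f t)
minimal-split f []       C≢[] = ⊥-elim (C≢[] refl)
minimal-split f (c ∷ cs) _    with ∈-∃++ ([ here , there ]′ (argmin-sel f c cs))
... | C₁ , C₂ , C≡ = C₁ , argmin f c cs , C₂ , C≡ , minimal
  where
  minimal : ∀ t → t ∈ c ∷ cs → f (argmin f c cs) ≤ f t
  minimal t (here refl)  = f[argmin]≤f[⊤] {f = f} c cs
  minimal t (there t∈cs) = All.lookup (f[argmin]≤f[xs] {f = f} c cs) t∈cs

-- Sign-compatibility and the conformal order

private
  i+[j-i]≡j : ∀ i j → i ℤ.+ (j ℤ.- i) ≡ j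
  i+[j-i]≡j = solve-∀

  [i+j]-i≡j : ∀ i j → (i ℤ.+ j) ℤ.- i ≡ j
  [i+j]-i≡j = solve-∀

  i-[i-j]≡j : ∀ i j → i ℤ.- (i ℤ.- j) ≡ j
  i-[i-j]≡j = solve-∀

  k-i≡[j-i]+[k-j] : ∀ i j k → k ℤ.- i ≡ (j ℤ.- i) ℤ.+ (k ℤ.- j)
  k-i≡[j-i]+[k-j] = solve-∀

  [[a+i]+[b+j]]-i≡j+[a+b] : ∀ a i b j → ((a ℤ.+ i) ℤ.+ (b ℤ.+ j)) ℤ.- i ≡ j ℤ.+ (a ℤ.+ b)
  [[a+i]+[b+j]]-i≡j+[a+b] = solve-∀

_⊑ℤ_ : ℤ → ℤ → Set
a ⊑ℤ b = 0ℤ ℤ.≤ a ℤ.* b × ∣ a ∣ ≤ ∣ b ∣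

SignCompatible : ℤ → ℤ → Set
SignCompatible (+ _)     (+ _)     = ⊤
SignCompatible -[1+ _ ]  -[1+ _ ]  = ⊤
SignCompatible +0        -[1+ _ ]  = ⊤
SignCompatible +[1+ _ ]  -[1+ _ ]  = ⊥
SignCompatible -[1+ _ ]  +0        = ⊤
SignCompatible -[1+ _ ]  +[1+ _ ]  = ⊥

signCompatible? : ∀ a b → Dec (SignCompatible a b)
signCompatible? (+ _)     (+ _)     = yes tt
signCompatible? -[1+ _ ]  -[1+ _ ]  = yes tt
signCompatible? +0        -[1+ _ ]  = yes tt
signCompatible? +[1+ _ ]  -[1+ _ ]  = no λ ()
signCompatible? -[1+ _ ]  +0        = yes tt
signCompatible? -[1+ _ ]  +[1+ _ ]  = no λ ()

signCompatible-sym : ∀ a b → SignCompatible a b → SignCompatible b a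
signCompatible-sym (+ _)     (+ _)     _ = tt
signCompatible-sym -[1+ _ ]  -[1+ _ ]  _ = tt
signCompatible-sym +0        -[1+ _ ]  _ = tt
signCompatible-sym -[1+ _ ]  +0        _ = tt

signCompatible-zeroˡ : ∀ b → SignCompatible 0ℤ b
signCompatible-zeroˡ (+ _)    = tt
signCompatible-zeroˡ -[1+ _ ] = tt

signCompatible-zeroʳ : ∀ a → SignCompatible a 0ℤ
signCompatible-zeroʳ (+ _)    = tt
signCompatible-zeroʳ -[1+ _ ] = tt

signCompatible-+ʳ : ∀ a b c → SignCompatible a b → SignCompatible a c → SignCompatible a (b ℤ.+ c)
signCompatible-+ʳ +0        b          c          _ _ = signCompatible-zeroˡ (b ℤ.+ c)
signCompatible-+ʳ +[1+ _ ]  (+ _)      (+ _)      _ _ = tt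
signCompatible-+ʳ -[1+ _ ]  +0         +0         _ _ = tt
signCompatible-+ʳ -[1+ _ ]  +0         -[1+ _ ]   _ _ = tt
signCompatible-+ʳ -[1+ _ ]  -[1+ _ ]   +0         _ _ = tt
signCompatible-+ʳ -[1+ _ ]  -[1+ _ ]   -[1+ _ ]   _ _ = tt

signCompatible⇒∣+∣≡ : ∀ a b → SignCompatible a b → ∣ a ℤ.+ b ∣ ≡ ∣ a ∣ ℕ.+ ∣ b ∣
signCompatible⇒∣+∣≡ (+ _)     (+ _)     _ = refl
signCompatible⇒∣+∣≡ -[1+ m ]  -[1+ n ]  _ = cong suc (sym (ℕP.+-suc m n))
signCompatible⇒∣+∣≡ +0        -[1+ _ ]  _ = refl
signCompatible⇒∣+∣≡ -[1+ m ]  +0        _ = cong suc (sym (ℕP.+-identityʳ m))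

∣[1+m]⊖[1+n]∣<[1+m]+[1+n] : ∀ m n → ∣ suc m ℤ.⊖ suc n ∣ < suc m ℕ.+ suc n
∣[1+m]⊖[1+n]∣<[1+m]+[1+n] m n = ℕP.≤-<-trans (ℤP.∣m⊝n∣≤m⊔n (suc m) (suc n))
  (s≤s (ℕP.≤-<-trans (ℕP.m⊔n≤m+n m n) (ℕP.+-monoʳ-< m (ℕP.n<1+n n))))

∣+∣≡⇒signCompatible : ∀ a b → ∣ a ℤ.+ b ∣ ≡ ∣ a ∣ ℕ.+ ∣ b ∣ → SignCompatible a b
∣+∣≡⇒signCompatible (+ _)     (+ _)     _ = tt
∣+∣≡⇒signCompatible -[1+ _ ]  -[1+ _ ]  _ = tt
∣+∣≡⇒signCompatible +0        -[1+ _ ]  _ = tt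
∣+∣≡⇒signCompatible -[1+ _ ]  +0        _ = tt
∣+∣≡⇒signCompatible +[1+ m ]  -[1+ n ]  e = ⊥-elim (ℕP.<⇒≢ (∣[1+m]⊖[1+n]∣<[1+m]+[1+n] m n) e)
∣+∣≡⇒signCompatible -[1+ m ]  +[1+ n ]  e =
  ⊥-elim (ℕP.<⇒≢ (subst (∣ suc n ℤ.⊖ suc m ∣ <_) (ℕP.+-comm (suc n) (suc m)) (∣[1+m]⊖[1+n]∣<[1+m]+[1+n] n m)) e)

⊑ℤ⇒signCompatible : ∀ a b → a ⊑ℤ b → SignCompatible a (b ℤ.- a)
⊑ℤ⇒signCompatible +0        b          _        = signCompatible-zeroˡ (b ℤ.- +0)
⊑ℤ⇒signCompatible +[1+ m ]  (+ n)      (_ , le) rewrite ℤP.⊖-≥ le = tt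
⊑ℤ⇒signCompatible -[1+ m ]  -[1+ n ]   (_ , le) rewrite ℤP.⊖-≤ le with suc n ℕ.∸ suc m
... | zero  = tt
... | suc _ = tt
⊑ℤ⇒signCompatible +[1+ _ ]  -[1+ _ ]   (() , _)
⊑ℤ⇒signCompatible -[1+ _ ]  +0         (_ , ())
⊑ℤ⇒signCompatible -[1+ _ ]  +[1+ _ ]   (() , _)

signCompatible⇒⊑ℤ : ∀ a b → SignCompatible a (b ℤ.- a) → a ⊑ℤ b
signCompatible⇒⊑ℤ a b c = subst (a ⊑ℤ_) (i+[j-i]≡j a b) (sign a (b ℤ.- a) c , ∣a∣≤∣a+c∣)
  where
  sign : ∀ a c → SignCompatible a c → 0ℤ ℤ.≤ a ℤ.* (a ℤ.+ c)
  sign +0        c          _ = +≤+ z≤n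
  sign +[1+ _ ]  (+ _)      _ = +≤+ z≤n
  sign -[1+ _ ]  +0         _ = +≤+ z≤n
  sign -[1+ _ ]  -[1+ _ ]   _ = +≤+ z≤n
  ∣a∣≤∣a+c∣ : ∣ a ∣ ≤ ∣ a ℤ.+ (b ℤ.- a) ∣
  ∣a∣≤∣a+c∣ = subst (∣ a ∣ ≤_) (sym (signCompatible⇒∣+∣≡ a (b ℤ.- a) c)) (ℕP.m≤m+n ∣ a ∣ ∣ b ℤ.- a ∣)

infixl 6 _-ᵥ_
_-ᵥ_ : Vec ℤ m → Vec ℤ m → Vec ℤ m
_-ᵥ_ = zipWith ℤ._-_

∥_∥ : Vec ℤ m → ℕ
∥ u ∥ = V.sum (V.map ∣_∣ u)

+ᵥ-comm : (u w : Vec ℤ m) → u +ᵥ w ≡ w +ᵥ u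
+ᵥ-comm = VP.zipWith-comm ℤP.+-comm

+ᵥ-assoc : (u v w : Vec ℤ m) → (u +ᵥ v) +ᵥ w ≡ u +ᵥ (v +ᵥ w)
+ᵥ-assoc = VP.zipWith-assoc ℤP.+-assoc

+ᵥ-identityˡ : (u : Vec ℤ m) → zeroV +ᵥ u ≡ u
+ᵥ-identityˡ = VP.zipWith-identityˡ ℤP.+-identityˡ

+ᵥ-identityʳ : (u : Vec ℤ m) → u +ᵥ zeroV ≡ u
+ᵥ-identityʳ = VP.zipWith-identityʳ ℤP.+-identityʳ

u+[v-u]≡v : (u v : Vec ℤ m) → u +ᵥ (v -ᵥ u) ≡ v
u+[v-u]≡v []       []       = refl
u+[v-u]≡v (x ∷ u) (y ∷ v) = cong₂ _∷_ (i+[j-i]≡j x y) (u+[v-u]≡v u v)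

[u+v]-u≡v : (u v : Vec ℤ m) → (u +ᵥ v) -ᵥ u ≡ v
[u+v]-u≡v []       []       = refl
[u+v]-u≡v (x ∷ u) (y ∷ v) = cong₂ _∷_ ([i+j]-i≡j x y) ([u+v]-u≡v u v)

u-[u-v]≡v : (u v : Vec ℤ m) → u -ᵥ (u -ᵥ v) ≡ v
u-[u-v]≡v []       []       = refl
u-[u-v]≡v (x ∷ u) (y ∷ v) = cong₂ _∷_ (i-[i-j]≡j x y) (u-[u-v]≡v u v)

w-u≡[v-u]+[w-v] : (u v w : Vec ℤ m) → w -ᵥ u ≡ (v -ᵥ u) +ᵥ (w -ᵥ v)
w-u≡[v-u]+[w-v] []       []       []       = refl
w-u≡[v-u]+[w-v] (x ∷ u) (y ∷ v) (z ∷ w) = cong₂ _∷_ (k-i≡[j-i]+[k-j] x y z) (w-u≡[v-u]+[w-v] u v w)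

+ᵥ-interchange : (u v w x : Vec ℤ m) → (u +ᵥ v) +ᵥ (w +ᵥ x) ≡ (u +ᵥ w) +ᵥ (v +ᵥ x)
+ᵥ-interchange []      []      []      []      = refl
+ᵥ-interchange (a ∷ u) (b ∷ v) (c ∷ w) (d ∷ x) = cong₂ _∷_ (+ℤ-interchange a b c d) (+ᵥ-interchange u v w x)

·ᵥ-distribʳ-+ : ∀ a b (u : Vec ℤ m) → (a ℤ.+ b) ·ᵥ u ≡ (a ·ᵥ u) +ᵥ (b ·ᵥ u)
·ᵥ-distribʳ-+ a b []      = refl
·ᵥ-distribʳ-+ a b (x ∷ u) = cong₂ _∷_ (ℤP.*-distribʳ-+ x a b) (·ᵥ-distribʳ-+ a b u)

0·ᵥu≡0 : (u : Vec ℤ m) → 0ℤ ·ᵥ u ≡ zeroV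
0·ᵥu≡0 []      = refl
0·ᵥu≡0 (_ ∷ u) = cong (0ℤ ∷_) (0·ᵥu≡0 u)

u-u≡0 : (u : Vec ℤ m) → u -ᵥ u ≡ zeroV
u-u≡0 []      = refl
u-u≡0 (x ∷ u) = cong₂ _∷_ (ℤP.+-inverseʳ x) (u-u≡0 u)

v-u≡0⇒u≡v : (u v : Vec ℤ m) → v -ᵥ u ≡ zeroV → u ≡ v
v-u≡0⇒u≡v u v e = begin
  u                  ≡⟨ +ᵥ-identityʳ u ⟨
  u +ᵥ zeroV         ≡⟨ cong (u +ᵥ_) e ⟨
  u +ᵥ (v -ᵥ u)      ≡⟨ u+[v-u]≡v u v ⟩
  v                  ∎
  where open ≡-Reasoning

∥zeroV∥≡0 : ∥ zeroV {m} ∥ ≡ 0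
∥zeroV∥≡0 {zero}  = refl
∥zeroV∥≡0 {suc m} = ∥zeroV∥≡0 {m}

∥u∥≡0⇒u≡0 : (u : Vec ℤ m) → ∥ u ∥ ≡ 0 → u ≡ zeroV
∥u∥≡0⇒u≡0 []      _ = refl
∥u∥≡0⇒u≡0 (x ∷ u) e = cong₂ _∷_ (ℤP.∣i∣≡0⇒i≡0 (ℕP.m+n≡0⇒m≡0 _ e)) (∥u∥≡0⇒u≡0 u (ℕP.m+n≡0⇒n≡0 ∣ x ∣ e))

u≢0⇒∥u∥>0 : (u : Vec ℤ m) → u ≢ zeroV → 0 < ∥ u ∥
u≢0⇒∥u∥>0 u u≢0 = ℕP.n≢0⇒n>0 (u≢0 ∘ ∥u∥≡0⇒u≡0 u)

∥u+v∥≤∥u∥+∥v∥ : (u v : Vec ℤ m) → ∥ u +ᵥ v ∥ ≤ ∥ u ∥ ℕ.+ ∥ v ∥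
∥u+v∥≤∥u∥+∥v∥ []      []      = z≤n
∥u+v∥≤∥u∥+∥v∥ (x ∷ u) (y ∷ v) = ℕP.≤-trans (ℕP.+-mono-≤ (ℤP.∣i+j∣≤∣i∣+∣j∣ x y) (∥u+v∥≤∥u∥+∥v∥ u v))
  (ℕP.≤-reflexive (+-interchange (∣ x ∣) (∣ y ∣) (∥ u ∥) (∥ v ∥)))

≤∧≤∧+≡⇒≡ : ∀ {k l k′ l′} → k ≤ k′ → l ≤ l′ → k ℕ.+ l ≡ k′ ℕ.+ l′ → k ≡ k′ × l ≡ l′
≤∧≤∧+≡⇒≡ {k} {l} {k′} {l′} k≤k′ l≤l′ e with ℕP.m≤n⇒m<n∨m≡n k≤k′
... | inj₁ k<k′ = ⊥-elim (ℕP.<⇒≢ (ℕP.+-mono-<-≤ k<k′ l≤l′) e)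
... | inj₂ refl = refl , ℕP.+-cancelˡ-≡ k l l′ e

Compatible : Vec ℤ m → Vec ℤ m → Set
Compatible = Pointwise SignCompatible

compatible? : (u v : Vec ℤ m) → Dec (Compatible u v)
compatible? = Pointwise.decidable signCompatible?

compatible-sym : {u v : Vec ℤ m} → Compatible u v → Compatible v u
compatible-sym []                    = []
compatible-sym (_∷_ {x = x} {y} c cs) = signCompatible-sym x y c ∷ compatible-sym cs

compatible-zeroʳ : (u : Vec ℤ m) → Compatible u zeroV
compatible-zeroʳ []      = []
compatible-zeroʳ (x ∷ u) = signCompatible-zeroʳ x ∷ compatible-zeroʳ u

compatible-+ʳ : (u v w : Vec ℤ m) → Compatible u v → Compatible u w → Compatible u (v +ᵥ w)
compatible-+ʳ []      []      []      []       []       = []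
compatible-+ʳ (x ∷ u) (y ∷ v) (z ∷ w) (c ∷ cs) (d ∷ ds) = signCompatible-+ʳ x y z c d ∷ compatible-+ʳ u v w cs ds

compatible⇒∥u+v∥≡∥u∥+∥v∥ : (u v : Vec ℤ m) → Compatible u v → ∥ u +ᵥ v ∥ ≡ ∥ u ∥ ℕ.+ ∥ v ∥
compatible⇒∥u+v∥≡∥u∥+∥v∥ []      []      []       = refl
compatible⇒∥u+v∥≡∥u∥+∥v∥ (x ∷ u) (y ∷ v) (c ∷ cs) =
  trans (cong₂ ℕ._+_ (signCompatible⇒∣+∣≡ x y c) (compatible⇒∥u+v∥≡∥u∥+∥v∥ u v cs))
        (+-interchange (∣ x ∣) (∣ y ∣) (∥ u ∥) (∥ v ∥))

∥u+v∥≡∥u∥+∥v∥⇒compatible : (u v : Vec ℤ m) → ∥ u +ᵥ v ∥ ≡ ∥ u ∥ ℕ.+ ∥ v ∥ → Compatible u v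
∥u+v∥≡∥u∥+∥v∥⇒compatible []      []      _ = []
∥u+v∥≡∥u∥+∥v∥⇒compatible (x ∷ u) (y ∷ v) e =
  ∣+∣≡⇒signCompatible x y (proj₁ split) ∷ ∥u+v∥≡∥u∥+∥v∥⇒compatible u v (proj₂ split)
  where
  split : ∣ x ℤ.+ y ∣ ≡ ∣ x ∣ ℕ.+ ∣ y ∣ × ∥ u +ᵥ v ∥ ≡ ∥ u ∥ ℕ.+ ∥ v ∥
  split = ≤∧≤∧+≡⇒≡ (ℤP.∣i+j∣≤∣i∣+∣j∣ x y) (∥u+v∥≤∥u∥+∥v∥ u v)
            (trans e (+-interchange (∣ x ∣) (∥ u ∥) (∣ y ∣) (∥ v ∥)))

⊑-∷⁻ : ∀ {x y} {u v : Vec ℤ m} → (x ∷ u) ⊑ (y ∷ v) → x ⊑ℤ y × u ⊑ v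
⊑-∷⁻ x∷u⊑y∷v = x∷u⊑y∷v Fin.zero , x∷u⊑y∷v ∘ Fin.suc

⊑-∷⁺ : ∀ {x y} {u v : Vec ℤ m} → x ⊑ℤ y → u ⊑ v → (x ∷ u) ⊑ (y ∷ v)
⊑-∷⁺ x⊑y u⊑v Fin.zero    = x⊑y
⊑-∷⁺ x⊑y u⊑v (Fin.suc j) = u⊑v j

⊑⇒compatible : (u v : Vec ℤ m) → u ⊑ v → Compatible u (v -ᵥ u)
⊑⇒compatible []      []      _   = []
⊑⇒compatible (x ∷ u) (y ∷ v) u⊑v =
  ⊑ℤ⇒signCompatible x y (proj₁ (⊑-∷⁻ u⊑v)) ∷ ⊑⇒compatible u v (proj₂ (⊑-∷⁻ u⊑v))

compatible⇒⊑ : (u v : Vec ℤ m) → Compatible u (v -ᵥ u) → u ⊑ v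
compatible⇒⊑ []      []      _        ()
compatible⇒⊑ (x ∷ u) (y ∷ v) (c ∷ cs) = ⊑-∷⁺ (signCompatible⇒⊑ℤ x y c) (compatible⇒⊑ u v cs)

⊑⇒∥v∥≡∥u∥+∥v-u∥ : (u v : Vec ℤ m) → u ⊑ v → ∥ v ∥ ≡ ∥ u ∥ ℕ.+ ∥ v -ᵥ u ∥
⊑⇒∥v∥≡∥u∥+∥v-u∥ u v u⊑v =
  trans (cong ∥_∥ (sym (u+[v-u]≡v u v))) (compatible⇒∥u+v∥≡∥u∥+∥v∥ u (v -ᵥ u) (⊑⇒compatible u v u⊑v))

∥v∥≡∥u∥+∥v-u∥⇒⊑ : (u v : Vec ℤ m) → ∥ v ∥ ≡ ∥ u ∥ ℕ.+ ∥ v -ᵥ u ∥ → u ⊑ v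
∥v∥≡∥u∥+∥v-u∥⇒⊑ u v e =
  compatible⇒⊑ u v (∥u+v∥≡∥u∥+∥v∥⇒compatible u (v -ᵥ u) (trans (cong ∥_∥ (u+[v-u]≡v u v)) e))

⊑∧≢⇒∥u∥<∥v∥ : (u v : Vec ℤ m) → u ⊑ v → u ≢ v → ∥ u ∥ < ∥ v ∥
⊑∧≢⇒∥u∥<∥v∥ u v u⊑v u≢v = subst (∥ u ∥ <_) (sym (⊑⇒∥v∥≡∥u∥+∥v-u∥ u v u⊑v))
  (ℕP.m<m+n ∥ u ∥ (u≢0⇒∥u∥>0 (v -ᵥ u) (u≢v ∘ v-u≡0⇒u≡v u v)))

⊑-refl : (u : Vec ℤ m) → u ⊑ u
⊑-refl {m} u = ∥v∥≡∥u∥+∥v-u∥⇒⊑ u u (sym (trans (cong (λ w → ∥ u ∥ ℕ.+ ∥ w ∥) (u-u≡0 u))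
                                              (trans (cong (∥ u ∥ ℕ.+_) (∥zeroV∥≡0 {m})) (ℕP.+-identityʳ ∥ u ∥))))

⊑-trans : (u v w : Vec ℤ m) → u ⊑ v → v ⊑ w → u ⊑ w
⊑-trans u v w u⊑v v⊑w = ∥v∥≡∥u∥+∥v-u∥⇒⊑ u w (ℕP.≤-antisym ≤-triangle ≥-split)
  where
  ≤-triangle : ∥ w ∥ ≤ ∥ u ∥ ℕ.+ ∥ w -ᵥ u ∥
  ≤-triangle = subst (_≤ ∥ u ∥ ℕ.+ ∥ w -ᵥ u ∥) (cong ∥_∥ (u+[v-u]≡v u w)) (∥u+v∥≤∥u∥+∥v∥ u (w -ᵥ u))
  ≥-split : ∥ u ∥ ℕ.+ ∥ w -ᵥ u ∥ ≤ ∥ w ∥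
  ≥-split = begin
    ∥ u ∥ ℕ.+ ∥ w -ᵥ u ∥                        ≡⟨ cong (λ x → ∥ u ∥ ℕ.+ ∥ x ∥) (w-u≡[v-u]+[w-v] u v w) ⟩
    ∥ u ∥ ℕ.+ ∥ (v -ᵥ u) +ᵥ (w -ᵥ v) ∥          ≤⟨ ℕP.+-monoʳ-≤ ∥ u ∥ (∥u+v∥≤∥u∥+∥v∥ (v -ᵥ u) (w -ᵥ v)) ⟩
    ∥ u ∥ ℕ.+ (∥ v -ᵥ u ∥ ℕ.+ ∥ w -ᵥ v ∥)       ≡⟨ ℕP.+-assoc ∥ u ∥ _ _ ⟨
    (∥ u ∥ ℕ.+ ∥ v -ᵥ u ∥) ℕ.+ ∥ w -ᵥ v ∥       ≡⟨ cong (ℕ._+ ∥ w -ᵥ v ∥) (⊑⇒∥v∥≡∥u∥+∥v-u∥ u v u⊑v) ⟨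
    ∥ v ∥ ℕ.+ ∥ w -ᵥ v ∥                        ≡⟨ ⊑⇒∥v∥≡∥u∥+∥v-u∥ v w v⊑w ⟨
    ∥ w ∥                                       ∎
    where open ℕP.≤-Reasoning

v-u⊑v : (u v : Vec ℤ m) → u ⊑ v → (v -ᵥ u) ⊑ v
v-u⊑v u v u⊑v = ∥v∥≡∥u∥+∥v-u∥⇒⊑ (v -ᵥ u) v (begin
  ∥ v ∥                         ≡⟨ ⊑⇒∥v∥≡∥u∥+∥v-u∥ u v u⊑v ⟩
  ∥ u ∥ ℕ.+ ∥ v -ᵥ u ∥           ≡⟨ ℕP.+-comm ∥ u ∥ _ ⟩
  ∥ v -ᵥ u ∥ ℕ.+ ∥ u ∥           ≡⟨ cong (λ x → ∥ v -ᵥ u ∥ ℕ.+ ∥ x ∥) (u-[u-v]≡v v u) ⟨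
  ∥ v -ᵥ u ∥ ℕ.+ ∥ v -ᵥ (v -ᵥ u) ∥ ∎)
  where open ≡-Reasoning

compatible⇒⊑+ : (u v : Vec ℤ m) → Compatible u v → u ⊑ (u +ᵥ v)
compatible⇒⊑+ u v u~v = ∥v∥≡∥u∥+∥v-u∥⇒⊑ u (u +ᵥ v)
  (trans (compatible⇒∥u+v∥≡∥u∥+∥v∥ u v u~v) (cong (λ x → ∥ u ∥ ℕ.+ ∥ x ∥) (sym ([u+v]-u≡v u v))))

_≟ᵥ_ : (u v : Vec ℤ m) → Dec (u ≡ v)
_≟ᵥ_ = VP.≡-dec ℤ._≟_

Reducible : List (Vec ℤ m) → Vec ℤ m → Set
Reducible G s = ∃ λ g → g ∈ G × g ⊑ s

_⊑?_ : (u v : Vec ℤ m) → Dec (u ⊑ v)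
u ⊑? v = FinP.all? λ j → (0ℤ ℤP.≤? lookup u j ℤ.* lookup v j) ×-dec (∣ lookup u j ∣ ℕP.≤? ∣ lookup v j ∣)

reducible? : (G : List (Vec ℤ m)) (s : Vec ℤ m) → Dec (Reducible G s)
reducible? G s = Dec.map′ find (λ (g , g∈G , g⊑s) → lose g∈G g⊑s) (Any.any? (_⊑? s) G)

compatible⇒⊑+ˡ : (u v : Vec ℤ m) → Compatible u v → v ⊑ (u +ᵥ v)
compatible⇒⊑+ˡ u v u~v = subst (v ⊑_) (+ᵥ-comm v u) (compatible⇒⊑+ v u (compatible-sym u~v))

-- Dickson's lemma

af-≤-or-≥ : ∀ k → AlmostFull (λ y z → y ≤ z ⊎ k ≤ y)
af-≤-or-≥ zero    = now λ _ _ → inj₂ z≤n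
af-≤-or-≥ (suc k) = later λ x → above-or-below x (suc k ℕP.≤? x)
  where
  above-or-below : ∀ x → Dec (suc k ≤ x) → AlmostFull (λ y z → (y ≤ z ⊎ suc k ≤ y) ⊎ (x ≤ y ⊎ suc k ≤ x))
  above-or-below x (yes k<x) = now λ _ _ → inj₂ (inj₂ k<x)
  above-or-below x (no  k≮x) = af-mono (Sum.map inj₁ (inj₁ ∘ ℕP.≤-trans (ℕP.≤-pred (ℕP.≰⇒> k≮x)))) (af-≤-or-≥ k)

af-≤ : AlmostFull _≤_
af-≤ = later af-≤-or-≥

af-≡-Sign : AlmostFull {Sign} _≡_
af-≡-Sign = later λ x → later λ y → now λ a _ → [ inj₁ ∘ inj₂ , inj₂ ]′ (two-of-three x y a)
  where
  two-of-three : ∀ x y a → x ≡ a ⊎ y ≡ a ⊎ x ≡ y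
  two-of-three Sign.+ Sign.+ _      = inj₂ (inj₂ refl)
  two-of-three Sign.- Sign.- _      = inj₂ (inj₂ refl)
  two-of-three Sign.+ Sign.- Sign.+ = inj₁ refl
  two-of-three Sign.+ Sign.- Sign.- = inj₂ (inj₁ refl)
  two-of-three Sign.- Sign.+ Sign.+ = inj₂ (inj₁ refl)
  two-of-three Sign.- Sign.+ Sign.- = inj₁ refl

af-⊑ℤ : AlmostFull _⊑ℤ_
af-⊑ℤ = af-mono sameSign⇒⊑ℤ (af-∩ (af-comap ℤ.sign af-≡-Sign) (af-comap ∣_∣ af-≤))
  where
  sameSign⇒⊑ℤ : ∀ {a b} → ℤ.sign a ≡ ℤ.sign b × ∣ a ∣ ≤ ∣ b ∣ → a ⊑ℤ b
  sameSign⇒⊑ℤ {+ m}      {+ n}      (_ , le) = subst (0ℤ ℤ.≤_) (ℤP.pos-* m n) (+≤+ z≤n) , le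
  sameSign⇒⊑ℤ { -[1+ _ ]} { -[1+ _ ]} (_ , le) = +≤+ z≤n , le
  sameSign⇒⊑ℤ {+ _}      { -[1+ _ ]} (() , _)
  sameSign⇒⊑ℤ { -[1+ _ ]} {+ _}      (() , _)

af-⊑ : ∀ m → AlmostFull (_⊑_ {m})
af-⊑ zero    = now λ { [] [] () }
af-⊑ (suc m) = af-mono (λ {u} {v} → cons u v) (af-∩ (af-comap V.head af-⊑ℤ) (af-comap V.tail (af-⊑ m)))
  where
  cons : ∀ (u v : Vec ℤ (suc m)) → V.head u ⊑ℤ V.head v × V.tail u ⊑ V.tail v → u ⊑ v
  cons (_ ∷ _) (_ ∷ _) (h , t) = ⊑-∷⁺ h t

-- Conformal sums

sumᵥ : List (Vec ℤ m) → Vec ℤ m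
sumᵥ = L.foldr _+ᵥ_ zeroV

sum∥∥ : List (Vec ℤ m) → ℕ
sum∥∥ = L.foldr (λ g k → ∥ g ∥ ℕ.+ k) 0

IsConformalSum : List (Vec ℤ m) → Set
IsConformalSum gs = ∥ sumᵥ gs ∥ ≡ sum∥∥ gs

sumᵥ-++ : (xs ys : List (Vec ℤ m)) → sumᵥ (xs ++ ys) ≡ sumᵥ xs +ᵥ sumᵥ ys
sumᵥ-++ []       ys = sym (+ᵥ-identityˡ (sumᵥ ys))
sumᵥ-++ (x ∷ xs) ys = trans (cong (x +ᵥ_) (sumᵥ-++ xs ys)) (sym (+ᵥ-assoc x (sumᵥ xs) (sumᵥ ys)))

sum∥∥-++ : (xs ys : List (Vec ℤ m)) → sum∥∥ (xs ++ ys) ≡ sum∥∥ xs ℕ.+ sum∥∥ ys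
sum∥∥-++ []       ys = refl
sum∥∥-++ (x ∷ xs) ys = trans (cong (∥ x ∥ ℕ.+_) (sum∥∥-++ xs ys)) (sym (ℕP.+-assoc ∥ x ∥ (sum∥∥ xs) (sum∥∥ ys)))

sumᵥ-middle : ∀ (xs : List (Vec ℤ m)) a ys → sumᵥ (xs ++ a ∷ ys) ≡ a +ᵥ sumᵥ (xs ++ ys)
sumᵥ-middle []       a ys = refl
sumᵥ-middle (x ∷ xs) a ys = begin
  x +ᵥ sumᵥ (xs ++ a ∷ ys)       ≡⟨ cong (x +ᵥ_) (sumᵥ-middle xs a ys) ⟩
  x +ᵥ (a +ᵥ sumᵥ (xs ++ ys))    ≡⟨ +ᵥ-assoc x a _ ⟨
  (x +ᵥ a) +ᵥ sumᵥ (xs ++ ys)    ≡⟨ cong (_+ᵥ sumᵥ (xs ++ ys)) (+ᵥ-comm x a) ⟩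
  (a +ᵥ x) +ᵥ sumᵥ (xs ++ ys)    ≡⟨ +ᵥ-assoc a x _ ⟩
  a +ᵥ sumᵥ (x ∷ xs ++ ys)       ∎
  where open ≡-Reasoning

sum∥∥-middle : ∀ (xs : List (Vec ℤ m)) a ys → sum∥∥ (xs ++ a ∷ ys) ≡ ∥ a ∥ ℕ.+ sum∥∥ (xs ++ ys)
sum∥∥-middle []       a ys = refl
sum∥∥-middle (x ∷ xs) a ys = trans (cong (∥ x ∥ ℕ.+_) (sum∥∥-middle xs a ys)) (x+[y+z]≡y+[x+z] ∥ x ∥ ∥ a ∥ _)

∥sumᵥ∥≤sum∥∥ : (gs : List (Vec ℤ m)) → ∥ sumᵥ gs ∥ ≤ sum∥∥ gs
∥sumᵥ∥≤sum∥∥ {m} []       = ℕP.≤-reflexive (∥zeroV∥≡0 {m})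
∥sumᵥ∥≤sum∥∥     (g ∷ gs) = ℕP.≤-trans (∥u+v∥≤∥u∥+∥v∥ g (sumᵥ gs)) (ℕP.+-monoʳ-≤ ∥ g ∥ (∥sumᵥ∥≤sum∥∥ gs))

conformal-∷ : ∀ {h} {gs : List (Vec ℤ m)} → Compatible h (sumᵥ gs) → IsConformalSum gs → IsConformalSum (h ∷ gs)
conformal-∷ {h = h} {gs} h~gs gs-conf = trans (compatible⇒∥u+v∥≡∥u∥+∥v∥ h (sumᵥ gs) h~gs) (cong (∥ h ∥ ℕ.+_) gs-conf)

conformal-++ : (xs ys : List (Vec ℤ m)) → Compatible (sumᵥ xs) (sumᵥ ys) →
  IsConformalSum xs → IsConformalSum ys → IsConformalSum (xs ++ ys)
conformal-++ xs ys xs~ys xs-conf ys-conf = begin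
  ∥ sumᵥ (xs ++ ys) ∥             ≡⟨ cong ∥_∥ (sumᵥ-++ xs ys) ⟩
  ∥ sumᵥ xs +ᵥ sumᵥ ys ∥          ≡⟨ compatible⇒∥u+v∥≡∥u∥+∥v∥ (sumᵥ xs) (sumᵥ ys) xs~ys ⟩
  ∥ sumᵥ xs ∥ ℕ.+ ∥ sumᵥ ys ∥     ≡⟨ cong₂ ℕ._+_ xs-conf ys-conf ⟩
  sum∥∥ xs ℕ.+ sum∥∥ ys           ≡⟨ sum∥∥-++ xs ys ⟨
  sum∥∥ (xs ++ ys)                ∎
  where open ≡-Reasoning

conformal-remove : ∀ (xs : List (Vec ℤ m)) a ys → IsConformalSum (xs ++ a ∷ ys) →
  IsConformalSum (xs ++ ys) × Compatible a (sumᵥ (xs ++ ys))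
conformal-remove xs a ys conf = rest-conf , ∥u+v∥≡∥u∥+∥v∥⇒compatible a R (trans ∥a+R∥≡ (cong (∥ a ∥ ℕ.+_) (sym rest-conf)))
  where
  R : Vec ℤ _
  R = sumᵥ (xs ++ ys)
  ∥a+R∥≡ : ∥ a +ᵥ R ∥ ≡ ∥ a ∥ ℕ.+ sum∥∥ (xs ++ ys)
  ∥a+R∥≡ = trans (cong ∥_∥ (sym (sumᵥ-middle xs a ys))) (trans conf (sum∥∥-middle xs a ys))
  rest-conf : IsConformalSum (xs ++ ys)
  rest-conf = ℕP.≤-antisym (∥sumᵥ∥≤sum∥∥ (xs ++ ys))
    (ℕP.+-cancelˡ-≤ ∥ a ∥ _ _ (ℕP.≤-trans (ℕP.≤-reflexive (sym ∥a+R∥≡)) (∥u+v∥≤∥u∥+∥v∥ a R)))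

compatible-sumᵥʳ : ∀ (u : Vec ℤ m) {gs} → All (Compatible u) gs → Compatible u (sumᵥ gs)
compatible-sumᵥʳ u []                = compatible-zeroʳ u
compatible-sumᵥʳ u (_∷_ {x = g} {gs} u~g u~gs) = compatible-+ʳ u g (sumᵥ gs) u~g (compatible-sumᵥʳ u u~gs)

incompatible-pair-or-compatible-sums : (xs ys : List (Vec ℤ m)) →
  (∃₂ λ a b → a ∈ xs × b ∈ ys × ¬ Compatible a b) ⊎ Compatible (sumᵥ xs) (sumᵥ ys)
incompatible-pair-or-compatible-sums []       ys = inj₂ (compatible-sym (compatible-zeroʳ (sumᵥ ys)))
incompatible-pair-or-compatible-sums (x ∷ xs) ys with All.all? (compatible? x) ys
... | no ¬x~ys with find (AllP.¬All⇒Any¬ (compatible? x) ys ¬x~ys)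
...   | b , b∈ys , x≁b = inj₁ (x , b , here refl , b∈ys , x≁b)
incompatible-pair-or-compatible-sums (x ∷ xs) ys | yes x~ys with incompatible-pair-or-compatible-sums xs ys
... | inj₁ (a , b , a∈xs , b∈ys , a≁b) = inj₁ (a , b , there a∈xs , b∈ys , a≁b)
... | inj₂ xs~ys = inj₂ (compatible-sym (compatible-+ʳ (sumᵥ ys) x (sumᵥ xs)
                          (compatible-sym (compatible-sumᵥʳ x x~ys)) (compatible-sym xs~ys)))

[[a+u]+[b+v]]-u≡v+[a+b] : (a u b v : Vec ℤ m) → ((a +ᵥ u) +ᵥ (b +ᵥ v)) -ᵥ u ≡ v +ᵥ (a +ᵥ b)
[[a+u]+[b+v]]-u≡v+[a+b] []      []      []      []      = refl
[[a+u]+[b+v]]-u≡v+[a+b] (a ∷ as) (i ∷ u) (b ∷ bs) (j ∷ v) =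
  cong₂ _∷_ ([[a+i]+[b+j]]-i≡j+[a+b] a i b j) ([[a+u]+[b+v]]-u≡v+[a+b] as u bs v)

incompatible⇒∥u+v∥<∥u∥+∥v∥ : (u v : Vec ℤ m) → ¬ Compatible u v → ∥ u +ᵥ v ∥ < ∥ u ∥ ℕ.+ ∥ v ∥
incompatible⇒∥u+v∥<∥u∥+∥v∥ u v u≁v = ℕP.≤∧≢⇒< (∥u+v∥≤∥u∥+∥v∥ u v) (u≁v ∘ ∥u+v∥≡∥u∥+∥v∥⇒compatible u v)

exchange-decreases : ∀ {a u b v x y : Vec ℤ m} → a +ᵥ u ≡ x → b +ᵥ v ≡ y →
  Compatible a u → Compatible b v → ¬ Compatible a b → ∥ u ∥ ℕ.+ ∥ (x +ᵥ y) -ᵥ u ∥ < ∥ x ∥ ℕ.+ ∥ y ∥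
exchange-decreases {a = a} {u} {b} {v} refl refl a~u b~v a≁b = begin-strict
  ∥ u ∥ ℕ.+ ∥ ((a +ᵥ u) +ᵥ (b +ᵥ v)) -ᵥ u ∥   ≡⟨ cong (λ x → ∥ u ∥ ℕ.+ ∥ x ∥) ([[a+u]+[b+v]]-u≡v+[a+b] a u b v) ⟩
  ∥ u ∥ ℕ.+ ∥ v +ᵥ (a +ᵥ b) ∥                 ≤⟨ ℕP.+-monoʳ-≤ (∥ u ∥) (∥u+v∥≤∥u∥+∥v∥ v (a +ᵥ b)) ⟩
  ∥ u ∥ ℕ.+ (∥ v ∥ ℕ.+ ∥ a +ᵥ b ∥)            <⟨ ℕP.+-monoʳ-< (∥ u ∥) (ℕP.+-monoʳ-< (∥ v ∥) (incompatible⇒∥u+v∥<∥u∥+∥v∥ a b a≁b)) ⟩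
  ∥ u ∥ ℕ.+ (∥ v ∥ ℕ.+ (∥ a ∥ ℕ.+ ∥ b ∥))     ≡⟨ regroup (∥ u ∥) (∥ v ∥) (∥ a ∥) (∥ b ∥) ⟩
  (∥ a ∥ ℕ.+ ∥ u ∥) ℕ.+ (∥ b ∥ ℕ.+ ∥ v ∥)     ≡⟨ cong₂ ℕ._+_ (compatible⇒∥u+v∥≡∥u∥+∥v∥ a u a~u) (compatible⇒∥u+v∥≡∥u∥+∥v∥ b v b~v) ⟨
  ∥ a +ᵥ u ∥ ℕ.+ ∥ b +ᵥ v ∥                   ∎
  where
  open ℕP.≤-Reasoning
  regroup : ∀ p q r s → p ℕ.+ (q ℕ.+ (r ℕ.+ s)) ≡ (r ℕ.+ p) ℕ.+ (s ℕ.+ q)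
  regroup = ℕSolver.solve-∀

-- Coordinate projection and permutation action

module _ {A : Set} where

  lookup-ext : ∀ {k} {u v : Vec A k} → (∀ i → lookup u i ≡ lookup v i) → u ≡ v
  lookup-ext {u = u} {v} u≗v = trans (sym (VP.tabulate∘lookup u)) (trans (VP.tabulate-cong u≗v) (VP.tabulate∘lookup v))

  -- proj d≤n and act σ are, definitionally, reindex (λ j → inject≤ j d≤n) and reindex (σ ⟨$⟩ʳ_).
  reindex : ∀ {k l} → (Fin k → Fin l) → Vec A l → Vec A k
  reindex r v = tabulate (lookup v ∘ r)

  module _ {k l} (r : Fin k → Fin l) where

    lookup-reindex : ∀ v i → lookup (reindex r v) i ≡ lookup v (r i)
    lookup-reindex v = VP.lookup∘tabulate (lookup v ∘ r)

    reindex-zipWith : ∀ (f : A → A → A) u v → reindex r (zipWith f u v) ≡ zipWith f (reindex r u) (reindex r v)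
    reindex-zipWith f u v = lookup-ext λ i → begin
      lookup (reindex r (zipWith f u v)) i                 ≡⟨ lookup-reindex (zipWith f u v) i ⟩
      lookup (zipWith f u v) (r i)                         ≡⟨ VP.lookup-zipWith f (r i) u v ⟩
      f (lookup u (r i)) (lookup v (r i))                  ≡⟨ cong₂ f (lookup-reindex u i) (lookup-reindex v i) ⟨
      f (lookup (reindex r u) i) (lookup (reindex r v) i)  ≡⟨ VP.lookup-zipWith f i (reindex r u) (reindex r v) ⟨
      lookup (zipWith f (reindex r u) (reindex r v)) i     ∎
      where open ≡-Reasoning

    reindex-replicate : ∀ x → reindex r (replicate l x) ≡ replicate k x
    reindex-replicate x = lookup-ext λ i →
      trans (lookup-reindex (replicate l x) i) (trans (VP.lookup-replicate (r i) x) (sym (VP.lookup-replicate i x)))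

reindex-⊑ : ∀ {k l} (r : Fin k → Fin l) (u v : Vec ℤ l) → u ⊑ v → reindex r u ⊑ reindex r v
reindex-⊑ r u v u⊑v j rewrite lookup-reindex r u j | lookup-reindex r v j = u⊑v (r j)

lincomb-+ᵥ : ∀ {n d} (B : Vec (Vec ℤ n) d) c c′ → lincomb B (c +ᵥ c′) ≡ lincomb B c +ᵥ lincomb B c′
lincomb-+ᵥ []      []      []       = sym (+ᵥ-identityˡ zeroV)
lincomb-+ᵥ (b ∷ B) (x ∷ c) (y ∷ c′) =
  trans (cong₂ _+ᵥ_ (·ᵥ-distribʳ-+ x y b) (lincomb-+ᵥ B c c′)) (+ᵥ-interchange _ _ _ _)

lincomb-zeroV : ∀ {n d} (B : Vec (Vec ℤ n) d) → lincomb B zeroV ≡ zeroV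
lincomb-zeroV []      = refl
lincomb-zeroV (b ∷ B) = trans (cong₂ _+ᵥ_ (0·ᵥu≡0 b) (lincomb-zeroV B)) (+ᵥ-identityˡ zeroV)

module _ {n d} (B : Vec (Vec ℤ n) d) where

  inLattice-zeroV : InLattice B zeroV
  inLattice-zeroV = zeroV , sym (lincomb-zeroV B)

  inLattice-+ᵥ : ∀ {u v} → InLattice B u → InLattice B v → InLattice B (u +ᵥ v)
  inLattice-+ᵥ (c , refl) (c′ , refl) = c +ᵥ c′ , sym (lincomb-+ᵥ B c c′)

  inLattice--ᵥ : ∀ {u v} → InLattice B u → InLattice B v → InLattice B (u -ᵥ v)
  inLattice--ᵥ (c , refl) (c′ , refl) = c -ᵥ c′ , (begin
    lincomb B c -ᵥ lincomb B c′                            ≡⟨ cong (λ x → lincomb B x -ᵥ lincomb B c′) (u+[v-u]≡v c′ c) ⟨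
    lincomb B (c′ +ᵥ (c -ᵥ c′)) -ᵥ lincomb B c′            ≡⟨ cong (_-ᵥ lincomb B c′) (lincomb-+ᵥ B c′ (c -ᵥ c′)) ⟩
    (lincomb B c′ +ᵥ lincomb B (c -ᵥ c′)) -ᵥ lincomb B c′  ≡⟨ [u+v]-u≡v (lincomb B c′) _ ⟩
    lincomb B (c -ᵥ c′)                                    ∎)
    where open ≡-Reasoning

module _ {n d} (d≤n : d ≤ n) where

  private
    ι : Fin d → Fin n
    ι j = inject≤ j d≤n

  proj--ᵥ : (u v : Vec ℤ n) → proj d≤n (u -ᵥ v) ≡ proj d≤n u -ᵥ proj d≤n v
  proj--ᵥ = reindex-zipWith ι ℤ._-_

  proj-zeroV : proj d≤n (zeroV {n}) ≡ zeroV
  proj-zeroV = reindex-replicate ι 0ℤ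

  proj-⊑ : (u v : Vec ℤ n) → u ⊑ v → proj d≤n u ⊑ proj d≤n v
  proj-⊑ = reindex-⊑ ι

module _ {n : ℕ} where

  act-+ᵥ : ∀ σ (u v : Vec ℤ n) → act σ (u +ᵥ v) ≡ act σ u +ᵥ act σ v
  act-+ᵥ σ = reindex-zipWith (σ ⟨$⟩ʳ_) ℤ._+_

  act-zeroV : ∀ σ → act σ (zeroV {n}) ≡ zeroV
  act-zeroV σ = reindex-replicate (σ ⟨$⟩ʳ_) 0ℤ

  act-⊑ : ∀ σ (u v : Vec ℤ n) → u ⊑ v → act σ u ⊑ act σ v
  act-⊑ σ = reindex-⊑ (σ ⟨$⟩ʳ_)

  act-∘ : ∀ σ τ (v : Vec ℤ n) → act σ (act τ v) ≡ act (σ ∘ₚ τ) v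
  act-∘ σ τ v = lookup-ext λ i → begin
    lookup (act σ (act τ v)) i       ≡⟨ lookup-reindex (σ ⟨$⟩ʳ_) (act τ v) i ⟩
    lookup (act τ v) (σ ⟨$⟩ʳ i)      ≡⟨ lookup-reindex (τ ⟨$⟩ʳ_) v (σ ⟨$⟩ʳ i) ⟩
    lookup v (τ ⟨$⟩ʳ (σ ⟨$⟩ʳ i))     ≡⟨ lookup-reindex ((σ ∘ₚ τ) ⟨$⟩ʳ_) v i ⟨
    lookup (act (σ ∘ₚ τ) v) i        ∎
    where open ≡-Reasoning

  act-cong : ∀ σ τ → σ ≈ₚ τ → (v : Vec ℤ n) → act σ v ≡ act τ v
  act-cong σ τ σ≈τ v = VP.tabulate-cong (cong (lookup v) ∘ σ≈τ)

  act-id : (v : Vec ℤ n) → act idₚ v ≡ v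
  act-id = VP.tabulate∘lookup

  act-inverseˡ : ∀ σ ρ → ρ ≈ₚ flip σ → (v : Vec ℤ n) → act ρ (act σ v) ≡ v
  act-inverseˡ σ ρ ρ≈σ⁻¹ v = trans (act-∘ ρ σ v) (trans (act-cong (ρ ∘ₚ σ) idₚ ρ∘σ≈id v) (act-id v))
    where
    ρ∘σ≈id : (ρ ∘ₚ σ) ≈ₚ idₚ
    ρ∘σ≈id i = trans (cong (σ ⟨$⟩ʳ_) (ρ≈σ⁻¹ i)) (inverseʳ σ)

  act-inverseʳ : ∀ σ ρ → ρ ≈ₚ flip σ → (v : Vec ℤ n) → act σ (act ρ v) ≡ v
  act-inverseʳ σ ρ ρ≈σ⁻¹ v = trans (act-∘ σ ρ v) (trans (act-cong (σ ∘ₚ ρ) idₚ σ∘ρ≈id v) (act-id v))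
    where
    σ∘ρ≈id : (σ ∘ₚ ρ) ≈ₚ idₚ
    σ∘ρ≈id i = trans (ρ≈σ⁻¹ (σ ⟨$⟩ʳ i)) (inverseˡ σ)

  act-injective : ∀ σ {u v : Vec ℤ n} → act σ u ≡ act σ v → u ≡ v
  act-injective σ {u} {v} e = begin
    u                          ≡⟨ act-inverseˡ σ (flip σ) (λ _ → refl) u ⟨
    act (flip σ) (act σ u)     ≡⟨ cong (act (flip σ)) e ⟩
    act (flip σ) (act σ v)     ≡⟨ act-inverseˡ σ (flip σ) (λ _ → refl) v ⟩
    v                          ∎
    where open ≡-Reasoning

  act-≢zeroV : ∀ σ {v : Vec ℤ n} → v ≢ zeroV → act σ v ≢ zeroV
  act-≢zeroV σ v≢0 e = v≢0 (act-injective σ (trans e (sym (act-zeroV σ))))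

  module _ (S : List (Permutation′ n)) where

    ∈-orbAll⁺ : ∀ {Gs r v} → r ∈ Gs → InOrb S r v → v ∈ orbAll S Gs
    ∈-orbAll⁺ {r = r} r∈Gs (σ , σ∈S , refl) = ∈-concatMap⁺ (orb S) (lose r∈Gs (∈-map⁺ (λ σ → act σ r) σ∈S))

    ∈-orbAll⁻ : ∀ Gs {v} → v ∈ orbAll S Gs → ∃ λ r → r ∈ Gs × InOrb S r v
    ∈-orbAll⁻ Gs v∈ with find (∈-concatMap⁻ (orb S) {xs = Gs} v∈)
    ... | r , r∈Gs , v∈orb with ∈-map⁻ (λ σ → act σ r) v∈orb
    ...   | σ , σ∈S , v≡σr = r , r∈Gs , σ , σ∈S , v≡σr

    orbAll-++⁺ˡ : ∀ Gs Hs {v} → v ∈ orbAll S Gs → v ∈ orbAll S (Gs ++ Hs)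
    orbAll-++⁺ˡ Gs Hs v∈ with ∈-orbAll⁻ Gs v∈
    ... | r , r∈Gs , r~v = ∈-orbAll⁺ (∈-++⁺ˡ r∈Gs) r~v

    orbAll-snoc⁻ : ∀ Gs f {v} → v ∈ orbAll S (Gs ++ f ∷ []) → v ∈ orbAll S Gs ⊎ InOrb S f v
    orbAll-snoc⁻ Gs f v∈ with ∈-orbAll⁻ (Gs ++ f ∷ []) v∈
    ... | r , r∈ , r~v with ∈-++⁻ Gs r∈
    ...   | inj₁ r∈Gs        = inj₁ (∈-orbAll⁺ r∈Gs r~v)
    ...   | inj₂ (here refl) = inj₂ r~v

    module _ (grp : IsPermGroup S) where

      identity∈S : ∃ λ ρ → ρ ∈ S × ∀ v → act ρ v ≡ v
      identity∈S with proj₁ grp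
      ... | ρ , ρ∈S , ρ≈id = ρ , ρ∈S , λ v → trans (act-cong ρ idₚ ρ≈id v) (act-id v)

      inverse∈S : ∀ {σ} → σ ∈ S → ∃ λ ρ → ρ ∈ S × (∀ v → act ρ (act σ v) ≡ v) × (∀ v → act σ (act ρ v) ≡ v)
      inverse∈S {σ} σ∈S with proj₂ (proj₂ grp) σ σ∈S
      ... | ρ , ρ∈S , ρ≈σ⁻¹ = ρ , ρ∈S , act-inverseˡ σ ρ ρ≈σ⁻¹ , act-inverseʳ σ ρ ρ≈σ⁻¹

      orbAll-closed : ∀ Gs {σ v} → σ ∈ S → v ∈ orbAll S Gs → act σ v ∈ orbAll S Gs
      orbAll-closed Gs {σ} σ∈S v∈ with ∈-orbAll⁻ Gs v∈
      ... | r , r∈Gs , τ , τ∈S , refl with proj₁ (proj₂ grp) σ τ σ∈S τ∈S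
      ...   | ρ , ρ∈S , ρ≈στ = ∈-orbAll⁺ r∈Gs (ρ , ρ∈S , trans (act-∘ σ τ r) (sym (act-cong ρ (σ ∘ₚ τ) ρ≈στ r)))

      ⊆-orbAll : ∀ Gs {r} → r ∈ Gs → r ∈ orbAll S Gs
      ⊆-orbAll Gs r∈Gs with identity∈S
      ... | ρ , ρ∈S , act-ρ = ∈-orbAll⁺ r∈Gs (ρ , ρ∈S , sym (act-ρ _))

-- Completion

open RawMonad (¬¬-Monad {0ℓ}) using (pure; _>>=_)

module Completion {n d} (d≤n : d ≤ n) (B : Vec (Vec ℤ n) d)
  (proj-injective : ∀ v w → InLattice B v → InLattice B w → proj d≤n v ≡ proj d≤n w → v ≡ w)
  (Fbar : Vec ℤ n → Set)
  (Fbar⊆Λ : ∀ v → Fbar v → InLattice B v)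
  (Fbar-minimal : ∀ u → (∃ λ v → Fbar v × proj d≤n v ≡ u) ⇔ MinimalNonzero (InProjLattice d≤n B) u)
  where

  π : Vec ℤ n → Vec ℤ d
  π = proj d≤n

  ‖_‖ : Vec ℤ n → ℕ
  ‖ v ‖ = ∥ π v ∥

  π-≢zeroV : ∀ {v} → InLattice B v → v ≢ zeroV → π v ≢ zeroV
  π-≢zeroV {v} v∈Λ v≢0 πv≡0 =
    v≢0 (proj-injective v zeroV v∈Λ (inLattice-zeroV B) (trans πv≡0 (sym (proj-zeroV d≤n))))

  π-⊑⇒π[v-u]⊑πv : ∀ u v → π u ⊑ π v → π (v -ᵥ u) ⊑ π v
  π-⊑⇒π[v-u]⊑πv u v πu⊑πv = subst (_⊑ π v) (sym (proj--ᵥ d≤n v u)) (v-u⊑v (π u) (π v) πu⊑πv)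

  π-⊑-summand : ∀ {a u x w} → a +ᵥ u ≡ x → Compatible a u → π x ⊑ π w → π u ⊑ π w
  π-⊑-summand {a} {u} {x} {w} refl a~u πx⊑πw =
    ⊑-trans (π u) (π x) (π w) (proj-⊑ d≤n u x (compatible⇒⊑+ˡ a u a~u)) πx⊑πw

  π-⊑⇒‖v-u‖<‖v‖ : ∀ {u v} → InLattice B u → u ≢ zeroV → π u ⊑ π v → ‖ v -ᵥ u ‖ < ‖ v ‖
  π-⊑⇒‖v-u‖<‖v‖ {u} {v} u∈Λ u≢0 πu⊑πv = subst₂ _<_ (cong ∥_∥ (sym (proj--ᵥ d≤n v u))) (sym ‖v‖≡)
    (ℕP.m<n+m ∥ π v -ᵥ π u ∥ (u≢0⇒∥u∥>0 (π u) (π-≢zeroV u∈Λ u≢0)))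
    where
    ‖v‖≡ : ‖ v ‖ ≡ ‖ u ‖ ℕ.+ ∥ π v -ᵥ π u ∥
    ‖v‖≡ = ⊑⇒∥v∥≡∥u∥+∥v-u∥ (π u) (π v) πu⊑πv

  minimal-below : ∀ {u} → Acc _<_ ∥ u ∥ → InProjLattice d≤n B u → u ≢ zeroV →
    ¬ ¬ (∃ λ u′ → MinimalNonzero (InProjLattice d≤n B) u′ × u′ ⊑ u)
  minimal-below {u} (acc rs) u∈πΛ u≢0 = ¬¬-excluded-middle {A = Smaller} >>= λ
    { (yes (u′ , u′∈πΛ , u′≢0 , u′⊑u , u′≢u)) →
        minimal-below (rs (⊑∧≢⇒∥u∥<∥v∥ u′ u u′⊑u u′≢u)) u′∈πΛ u′≢0 >>= λ (u″ , u″-min , u″⊑u′) →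
        pure (u″ , u″-min , ⊑-trans u″ u′ u u″⊑u′ u′⊑u)
    ; (no ∄smaller) → pure (u , (u∈πΛ , u≢0 , λ w w∈πΛ w≢0 w⊑u →
        decidable-stable (w ≟ᵥ u) (λ w≢u → ∄smaller (w , w∈πΛ , w≢0 , w⊑u , w≢u))) , ⊑-refl u)
    }
    where
    Smaller : Set
    Smaller = ∃ λ u′ → InProjLattice d≤n B u′ × u′ ≢ zeroV × u′ ⊑ u × u′ ≢ u

  Fbar-below : ∀ {w} → InLattice B w → w ≢ zeroV → ¬ ¬ (∃ λ f → Fbar f × π f ⊑ π w)
  Fbar-below {w} w∈Λ w≢0 =
    minimal-below (<-wellFounded ‖ w ‖) (w , w∈Λ , refl) (π-≢zeroV w∈Λ w≢0) >>= λ (u , u-min , u⊑πw) →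
    pure (lift (Equivalence.from (Fbar-minimal u) u-min) u⊑πw)
    where
    lift : ∀ {u} → (∃ λ f → Fbar f × π f ≡ u) → u ⊑ π w → ∃ λ f → Fbar f × π f ⊑ π w
    lift (f , f∈F̄ , refl) u⊑πw = f , f∈F̄ , u⊑πw

  Fbar⊆Graver : ∀ {v} → Fbar v → Graver B v
  Fbar⊆Graver {v} v∈F̄ = Fbar⊆Λ v v∈F̄ , v≢0 , minimal
    where
    πv-min : MinimalNonzero (InProjLattice d≤n B) (π v)
    πv-min = Equivalence.to (Fbar-minimal (π v)) (v , v∈F̄ , refl)
    v≢0 : v ≢ zeroV
    v≢0 v≡0 = proj₁ (proj₂ πv-min) (trans (cong π v≡0) (proj-zeroV d≤n))
    minimal : ∀ w → InLattice B w → w ≢ zeroV → w ⊑ v → w ≡ v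
    minimal w w∈Λ w≢0 w⊑v = proj-injective w v w∈Λ (Fbar⊆Λ v v∈F̄)
      (proj₂ (proj₂ πv-min) (π w) (w , w∈Λ , refl) (π-≢zeroV w∈Λ w≢0) (proj-⊑ d≤n w v w⊑v))

  module _ (G : List (Vec ℤ n))
    (G⊆Λ∖0 : ∀ {g} → g ∈ G → InLattice B g × g ≢ zeroV)
    (Fbar⊆G : ∀ {f} → Fbar f → f ∈ G)
    (μ : ℕ)
    (small-sums-reduce : ∀ {f g} → f ∈ G → g ∈ G → ‖ f +ᵥ g ‖ < μ → f +ᵥ g ≡ zeroV ⊎ Reducible G (f +ᵥ g))
    where

    record Decomposition (v : Vec ℤ n) : Set where
      constructor decomposition
      field
        parts     : List (Vec ℤ n)
        parts∈G   : All (_∈ G) parts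
        sum≡      : sumᵥ parts ≡ v
        conformal : IsConformalSum parts
    open Decomposition

    decomposition-zeroV : Decomposition zeroV
    decomposition-zeroV = decomposition [] [] refl (∥zeroV∥≡0 {n})

    decomposition-∷ : ∀ {g v} → g ∈ G → Compatible g v → Decomposition v → Decomposition (g +ᵥ v)
    decomposition-∷ {g} g∈G g~v (decomposition gs gs∈G refl gs-conf) =
      decomposition (g ∷ gs) (g∈G ∷ gs∈G) refl (conformal-∷ {gs = gs} g~v gs-conf)

    decomposition-++ : ∀ {x y} → Decomposition x → Decomposition y → Compatible x y → Decomposition (x +ᵥ y)
    decomposition-++ (decomposition xs xs∈G refl xs-conf) (decomposition ys ys∈G refl ys-conf) x~y =
      decomposition (xs ++ ys) (AllP.++⁺ xs∈G ys∈G) (sumᵥ-++ xs ys) (conformal-++ xs ys x~y xs-conf ys-conf)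

    decomposition-remove : ∀ {x a} (dx : Decomposition x) → a ∈ parts dx →
      ∃ λ x′ → Decomposition x′ × a +ᵥ x′ ≡ x × Compatible a x′
    decomposition-remove {a = a} (decomposition gs gs∈G refl gs-conf) a∈gs with ∈-∃++ a∈gs
    ... | xs , ys , refl with AllP.++⁻ xs gs∈G | conformal-remove xs a ys gs-conf
    ...   | xs∈G , _ ∷ ys∈G | rest-conf , a~rest =
      sumᵥ (xs ++ ys) , decomposition (xs ++ ys) (AllP.++⁺ xs∈G ys∈G) refl rest-conf ,
      sym (sumᵥ-middle xs a ys) , a~rest

    decomposition-inLattice : ∀ {v} → Decomposition v → InLattice B v
    decomposition-inLattice (decomposition gs gs∈G refl _) = sum∈Λ gs∈G
      where
      sum∈Λ : ∀ {gs} → All (_∈ G) gs → InLattice B (sumᵥ gs)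
      sum∈Λ []          = inLattice-zeroV B
      sum∈Λ (g∈G ∷ gs∈G) = inLattice-+ᵥ B (proj₁ (G⊆Λ∖0 g∈G)) (sum∈Λ gs∈G)

    decomposition-reducible : ∀ {v} → Decomposition v → v ≢ zeroV → Reducible G v
    decomposition-reducible (decomposition [] _ refl _) v≢0 = ⊥-elim (v≢0 refl)
    decomposition-reducible (decomposition (g ∷ gs) (g∈G ∷ _) refl conf) _ =
      g , g∈G , compatible⇒⊑+ g (sumᵥ gs) (proj₂ (conformal-remove [] g gs conf))

    module _ {w} (w∈Λ : InLattice B w) (w<μ : ‖ w ‖ < μ)
      (decompose-smaller : ∀ {v} → InLattice B v → ‖ v ‖ < ‖ w ‖ → ¬ ¬ Decomposition v)
      where

      decompose-complement : ∀ {u} → InLattice B u → u ≢ zeroV → π u ⊑ π w → ¬ ¬ Decomposition (w -ᵥ u)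
      decompose-complement u∈Λ u≢0 πu⊑πw =
        decompose-smaller (inLattice--ᵥ B w∈Λ u∈Λ) (π-⊑⇒‖v-u‖<‖v‖ {v = w} u∈Λ u≢0 πu⊑πw)

      decompose-reducible : ∀ {h} → h ∈ G → h ⊑ w → ¬ ¬ Decomposition w
      decompose-reducible {h} h∈G h⊑w with G⊆Λ∖0 h∈G
      ... | h∈Λ , h≢0 = decompose-complement h∈Λ h≢0 (proj-⊑ d≤n h w h⊑w) >>= λ d →
        pure (subst Decomposition (u+[v-u]≡v h w) (decomposition-∷ h∈G (⊑⇒compatible h w h⊑w) d))

      decompose-pair-sum : ∀ {a b} → a ∈ G → b ∈ G → a +ᵥ b ≡ w → ¬ ¬ Decomposition w
      decompose-pair-sum a∈G b∈G a+b≡w with small-sums-reduce a∈G b∈G (subst (λ s → ‖ s ‖ < μ) (sym a+b≡w) w<μ)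
      ... | inj₁ a+b≡0             = pure (subst Decomposition (trans (sym a+b≡0) a+b≡w) decomposition-zeroV)
      ... | inj₂ (h , h∈G , h⊑a+b) = decompose-reducible h∈G (subst (h ⊑_) a+b≡w h⊑a+b)

      -- Both halves are π-conformal to w. While they are not sign-compatible, take parts a of x and b of
      -- y that are not; keep the rest of x (or of y) and decompose its complement in w afresh.
      merge : ∀ {x y} → Acc _<_ (∥ x ∥ ℕ.+ ∥ y ∥) → Decomposition x → Decomposition y →
        x +ᵥ y ≡ w → π x ⊑ π w → π y ⊑ π w → ¬ ¬ Decomposition w
      merge {x} {y} (acc rs) dx dy x+y≡w πx⊑πw πy⊑πw = resolve (incompatible-pair-or-compatible-sums (parts dx) (parts dy))
        where
        keep-rest : ∀ {a u b v p q} → a +ᵥ u ≡ p → b +ᵥ v ≡ q → p +ᵥ q ≡ w → ∥ p ∥ ℕ.+ ∥ q ∥ ≡ ∥ x ∥ ℕ.+ ∥ y ∥ →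
          π p ⊑ π w → Compatible a u → Compatible b v → ¬ Compatible a b → Decomposition u → u ≢ zeroV →
          ¬ ¬ Decomposition w
        keep-rest {u = u} a+u≡p b+v≡q p+q≡w ∥p∥+∥q∥≡ πp⊑πw a~u b~v a≁b du u≢0 =
          decompose-complement (decomposition-inLattice du) u≢0 πu⊑πw >>= λ dz →
          merge (rs shrinks) du dz (u+[v-u]≡v u w) πu⊑πw (π-⊑⇒π[v-u]⊑πv u w πu⊑πw)
          where
          πu⊑πw : π u ⊑ π w
          πu⊑πw = π-⊑-summand {w = w} a+u≡p a~u πp⊑πw
          shrinks : ∥ u ∥ ℕ.+ ∥ w -ᵥ u ∥ < ∥ x ∥ ℕ.+ ∥ y ∥
          shrinks = subst₂ (λ s t → ∥ u ∥ ℕ.+ ∥ s -ᵥ u ∥ < t) p+q≡w ∥p∥+∥q∥≡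
            (exchange-decreases a+u≡p b+v≡q a~u b~v a≁b)
        trade : ∀ {a b} → ¬ Compatible a b → a ∈ G → b ∈ G →
          (∃ λ x′ → Decomposition x′ × a +ᵥ x′ ≡ x × Compatible a x′) →
          (∃ λ y′ → Decomposition y′ × b +ᵥ y′ ≡ y × Compatible b y′) → ¬ ¬ Decomposition w
        trade {a} {b} a≁b a∈G b∈G (x′ , dx′ , a+x′≡x , a~x′) (y′ , dy′ , b+y′≡y , b~y′) with x′ ≟ᵥ zeroV | y′ ≟ᵥ zeroV
        ... | no x′≢0  | _        = keep-rest a+x′≡x b+y′≡y x+y≡w refl πx⊑πw a~x′ b~y′ a≁b dx′ x′≢0
        ... | yes _    | no y′≢0  = keep-rest b+y′≡y a+x′≡x (trans (+ᵥ-comm y x) x+y≡w) (ℕP.+-comm (∥ y ∥) (∥ x ∥))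
                                      πy⊑πw b~y′ a~x′ (a≁b ∘ compatible-sym) dy′ y′≢0
        ... | yes refl | yes refl = decompose-pair-sum a∈G b∈G
          (trans (cong₂ _+ᵥ_ (trans (sym (+ᵥ-identityʳ a)) a+x′≡x) (trans (sym (+ᵥ-identityʳ b)) b+y′≡y)) x+y≡w)
        resolve : (∃₂ λ a b → a ∈ parts dx × b ∈ parts dy × ¬ Compatible a b) ⊎ Compatible (sumᵥ (parts dx)) (sumᵥ (parts dy)) →
          ¬ ¬ Decomposition w
        resolve (inj₁ (a , b , a∈x , b∈y , a≁b)) = trade a≁b (All.lookup (parts∈G dx) a∈x) (All.lookup (parts∈G dy) b∈y)
          (decomposition-remove dx a∈x) (decomposition-remove dy b∈y)
        resolve (inj₂ sums~) =
          pure (subst Decomposition x+y≡w (decomposition-++ dx dy (subst₂ Compatible (sum≡ dx) (sum≡ dy) sums~)))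

    decomposition-single : ∀ {g} → g ∈ G → Decomposition g
    decomposition-single {g} g∈G =
      subst Decomposition (+ᵥ-identityʳ g) (decomposition-∷ g∈G (compatible-zeroʳ g) decomposition-zeroV)

    decompose : ∀ {w} → Acc _<_ ‖ w ‖ → InLattice B w → ‖ w ‖ < μ → ¬ ¬ Decomposition w
    decompose {w} (acc rs) w∈Λ w<μ with w ≟ᵥ zeroV
    ... | yes refl = pure decomposition-zeroV
    ... | no w≢0   = Fbar-below w∈Λ w≢0 >>= λ (f , f∈F̄ , πf⊑πw) → split-off (Fbar⊆G f∈F̄) πf⊑πw
      where
      smaller : ∀ {v} → InLattice B v → ‖ v ‖ < ‖ w ‖ → ¬ ¬ Decomposition v
      smaller v∈Λ v<w = decompose (rs v<w) v∈Λ (ℕP.<-trans v<w w<μ)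
      split-off : ∀ {f} → f ∈ G → π f ⊑ π w → ¬ ¬ Decomposition w
      split-off {f} f∈G πf⊑πw =
        decompose-complement w∈Λ w<μ smaller (proj₁ (G⊆Λ∖0 f∈G)) (proj₂ (G⊆Λ∖0 f∈G)) πf⊑πw >>= λ dz →
        merge w∈Λ w<μ smaller (<-wellFounded _) (decomposition-single f∈G) dz
          (u+[v-u]≡v f w) πf⊑πw (π-⊑⇒π[v-u]⊑πv f w πf⊑πw)

    reducible : ∀ {w} → InLattice B w → w ≢ zeroV → ‖ w ‖ < μ → ¬ ¬ Reducible G w
    reducible w∈Λ w≢0 w<μ =
      decompose (<-wellFounded _) w∈Λ w<μ >>= λ dw → pure (decomposition-reducible dw w≢0)


-- Termination

IrreducibleExtension : Rel (List (Vec ℤ m)) 0ℓ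
IrreducibleExtension Hs Gs = ∃ λ f → Hs ≡ Gs ++ f ∷ [] × ¬ Reducible Gs f

private
  extend-reducibility : ∀ {R : Rel (Vec ℤ m) 0ℓ} Gs f → ¬ Reducible Gs f →
    R ⇒ (λ y z → y ⊑ z ⊎ Reducible Gs y) →
    (λ y z → R y z ⊎ R f y) ⇒ (λ y z → y ⊑ z ⊎ Reducible (Gs ++ f ∷ []) y)
  extend-reducibility Gs f f-irr R⇒ (inj₁ r) with R⇒ r
  ... | inj₁ y⊑z              = inj₁ y⊑z
  ... | inj₂ (g , g∈Gs , g⊑y) = inj₂ (g , ∈-++⁺ˡ g∈Gs , g⊑y)
  extend-reducibility Gs f f-irr R⇒ (inj₂ r) with R⇒ r
  ... | inj₁ f⊑y     = inj₂ (f , ∈-++⁺ʳ Gs (here refl) , f⊑y)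
  ... | inj₂ f-red   = ⊥-elim (f-irr f-red)

  irreducibleExtension-acc : ∀ {R : Rel (Vec ℤ m) 0ℓ} → AlmostFull R →
    ∀ Gs → R ⇒ (λ y z → y ⊑ z ⊎ Reducible Gs y) → Acc IrreducibleExtension Gs
  irreducibleExtension-acc (now r) Gs R⇒ = acc λ where
    (f , refl , f-irr) → acc λ where
      (f′ , refl , f′-irr) → ⊥-elim ([ f′-irr ∘ (λ f⊑f′ → f , ∈-++⁺ʳ Gs (here refl) , f⊑f′) , f-irr ]′ (R⇒ (r f f′)))
  irreducibleExtension-acc {R = R} (later r) Gs R⇒ = acc λ where
    (f , refl , f-irr) → irreducibleExtension-acc (r f) (Gs ++ f ∷ []) (extend-reducibility {R = R} Gs f f-irr R⇒)

irreducibleExtension-wellFounded : WellFounded (IrreducibleExtension {m})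
irreducibleExtension-wellFounded {m} Gs = irreducibleExtension-acc (af-⊑ m) Gs inj₁

NF-≢zeroV : ∀ {G s f} → NF {m} G s f → f ≢ zeroV → f ≡ s × ¬ Reducible G s
NF-≢zeroV (inj₁ (_ , f≡0))   f≢0 = ⊥-elim (f≢0 f≡0)
NF-≢zeroV (inj₂ (s-irr , f≡s)) _ = f≡s , s-irr

module _ {n d} (d≤n : d ≤ n) (S : List (Permutation′ n)) (grp : IsPermGroup S) where

  private
    measure : State n → List (Vec ℤ n) × ℕ
    measure st = Gsym st , L.length (Csym st)

    step-decreases : ∀ {st st′} → Step d≤n S st st′ →
      ×-Lex _≡_ IrreducibleExtension _<_ (measure st′) (measure st)
    step-decreases (drop Gs C₁ s C₂ _ _ _ _) =
      inj₂ (refl , ℕP.≤-reflexive (sym (length-++-sucʳ C₁ s C₂)))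
    step-decreases (add Gs C₁ s C₂ f _ nf f≢0) with NF-≢zeroV nf f≢0
    ... | refl , s-irr = inj₁ (f , refl , λ (g , g∈Gs , g⊑f) → s-irr (g , ⊆-orbAll S grp Gs g∈Gs , g⊑f))

  step-wellFounded : WellFounded (λ st′ st → Step d≤n S st st′)
  step-wellFounded = Subrelation.wellFounded step-decreases
    (On.wellFounded measure (×-wellFounded irreducibleExtension-wellFounded <-wellFounded))

module _ {n d} (d≤n : d ≤ n) (S : List (Permutation′ n)) where

  progress : ∀ st → Csym st ≢ [] → ∃ λ st′ → Step d≤n S st st′
  progress ⟨ Gs , C ⟩ C≢[] with minimal-split (orbNorm d≤n S) C C≢[]
  ... | C₁ , s , C₂ , refl , s-min with reducible? (orbAll S Gs) s | s ≟ᵥ zeroV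
  ...   | yes s-red | _        = _ , drop Gs C₁ s C₂ zeroV s-min (inj₁ (s-red , refl)) refl
  ...   | no  s-irr | yes s≡0  = _ , drop Gs C₁ s C₂ s s-min (inj₂ (s-irr , refl)) s≡0
  ...   | no  s-irr | no  s≢0  = _ , add Gs C₁ s C₂ s s-min (inj₂ (s-irr , refl)) s≢0

-- The invariant of the algorithm

module Algorithm {n d} (d≤n : d ≤ n) (B : Vec (Vec ℤ n) d) (S : List (Permutation′ n)) (Fbar : Vec ℤ n → Set)
  (proj-injective : ∀ v w → InLattice B v → InLattice B w → proj d≤n v ≡ proj d≤n w → v ≡ w)
  (grp : IsPermGroup S)
  (S-preserves-Λ : ∀ σ v → σ ∈ S → InLattice B v → InLattice B (act σ v))
  (Fbar⊆Λ : ∀ v → Fbar v → InLattice B v)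
  (Fbar-minimal : ∀ u → (∃ λ v → Fbar v × proj d≤n v ≡ u) ⇔ MinimalNonzero (InProjLattice d≤n B) u)
  where

  open Completion d≤n B proj-injective Fbar Fbar⊆Λ Fbar-minimal

  G : State n → List (Vec ℤ n)
  G st = orbAll S (Gsym st)

  Covered : List (Vec ℤ n) → List (Vec ℤ n) → Vec ℤ n → Set
  Covered G C w = w ≡ zeroV ⊎ Reducible G w ⊎ ∃ λ c → c ∈ C × InOrb S c w

  record Invariant (st : State n) : Set where
    field
      G⊆Graver     : ∀ {v} → v ∈ G st → Graver B v
      Fbar⊆G       : ∀ {v} → Fbar v → v ∈ G st
      Csym⊆Λ       : ∀ {c} → c ∈ Csym st → InLattice B c
      sums-covered : ∀ {f g} → f ∈ G st → g ∈ G st → Covered (G st) (Csym st) (f +ᵥ g)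
  open Invariant

  graver-act : ∀ {σ v} → σ ∈ S → Graver B v → Graver B (act σ v)
  graver-act {σ} {v} σ∈S (v∈Λ , v≢0 , v-min) with inverse∈S S grp σ∈S
  ... | ρ , ρ∈S , ρσ≗id , σρ≗id = S-preserves-Λ σ v σ∈S v∈Λ , act-≢zeroV σ v≢0 , minimal
    where
    minimal : ∀ w → InLattice B w → w ≢ zeroV → w ⊑ act σ v → w ≡ act σ v
    minimal w w∈Λ w≢0 w⊑σv = trans (sym (σρ≗id w)) (cong (act σ) (v-min (act ρ w) (S-preserves-Λ ρ w ρ∈S w∈Λ)
      (act-≢zeroV ρ w≢0) (subst (act ρ w ⊑_) (ρσ≗id v) (act-⊑ ρ w (act σ v) w⊑σv))))

  orbNorm≤ : ∀ {σ} v → σ ∈ S → orbNorm d≤n S v ≤ ‖ act σ v ‖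
  orbNorm≤ v σ∈S = foldr-⊓-≤ (norm d≤n v) (∈-map⁺ (λ σ → norm d≤n (act σ v)) σ∈S)

  orbNorm-attained : ∀ v → ∃ λ τ → τ ∈ S × orbNorm d≤n S v ≡ ‖ act τ v ‖
  orbNorm-attained v with foldr-selective ℕP.⊓-sel (norm d≤n v) (L.map (λ σ → norm d≤n (act σ v)) S)
  ... | inj₁ orbNorm≡‖v‖ with identity∈S S grp
  ...   | ρ , ρ∈S , ρ≗id = ρ , ρ∈S , trans orbNorm≡‖v‖ (cong ‖_‖ (sym (ρ≗id v)))
  orbNorm-attained v | inj₂ orbNorm∈ with ∈-map⁻ (λ σ → norm d≤n (act σ v)) orbNorm∈
  ... | τ , τ∈S , orbNorm≡ = τ , τ∈S , orbNorm≡

  module _ {st : State n} (inv : Invariant st) where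

    G⊆Λ∖0 : ∀ {g} → g ∈ G st → InLattice B g × g ≢ zeroV
    G⊆Λ∖0 g∈G = proj₁ (G⊆Graver inv g∈G) , proj₁ (proj₂ (G⊆Graver inv g∈G))

    -- A sum covered by a pending candidate has norm at least that candidate's orbit norm.
    small-sums-reduce : ∀ {μ} → (∀ {t} → t ∈ Csym st → μ ≤ orbNorm d≤n S t) →
      ∀ {f g} → f ∈ G st → g ∈ G st → ‖ f +ᵥ g ‖ < μ → f +ᵥ g ≡ zeroV ⊎ Reducible (G st) (f +ᵥ g)
    small-sums-reduce μ≤C f∈G g∈G f+g<μ with sums-covered inv f∈G g∈G
    ... | inj₁ f+g≡0                          = inj₁ f+g≡0
    ... | inj₂ (inj₁ f+g-red)                 = inj₂ f+g-red
    ... | inj₂ (inj₂ (c , c∈C , σ , σ∈S , f+g≡σc)) =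
      ⊥-elim (ℕP.<⇒≱ f+g<μ (ℕP.≤-trans (μ≤C c∈C) (subst (λ x → _ ≤ ‖ x ‖) (sym f+g≡σc) (orbNorm≤ c σ∈S))))

    reducible-below : ∀ {μ} → (∀ {t} → t ∈ Csym st → μ ≤ orbNorm d≤n S t) →
      ∀ {w} → InLattice B w → w ≢ zeroV → ‖ w ‖ < μ → ¬ ¬ Reducible (G st) w
    reducible-below {μ} μ≤C = reducible (G st) G⊆Λ∖0 (Fbar⊆G inv) μ (small-sums-reduce μ≤C)

    invariant⇒graver : Csym st ≡ [] → ∀ v → v ∈ G st ⇔ Graver B v
    invariant⇒graver C≡[] v = mk⇔ (G⊆Graver inv) graver⇒∈G
      where
      no-candidates : ∀ {t} → t ∈ Csym st → suc ‖ v ‖ ≤ orbNorm d≤n S t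
      no-candidates t∈C with subst (_ ∈_) C≡[] t∈C
      ... | ()
      graver⇒∈G : Graver B v → v ∈ G st
      graver⇒∈G (v∈Λ , v≢0 , v-min) = decidable-stable (Any.any? (v ≟ᵥ_) (G st))
        (reducible-below no-candidates v∈Λ v≢0 (ℕP.n<1+n _) >>= λ (g , g∈G , g⊑v) →
         pure (subst (_∈ G st) (v-min g (proj₁ (G⊆Λ∖0 g∈G)) (proj₂ (G⊆Λ∖0 g∈G)) g⊑v) g∈G))

  ⊑∧≢⇒‖u‖<‖v‖ : ∀ {u v} → InLattice B u → InLattice B v → u ⊑ v → u ≢ v → ‖ u ‖ < ‖ v ‖
  ⊑∧≢⇒‖u‖<‖v‖ {u} {v} u∈Λ v∈Λ u⊑v u≢v =
    ⊑∧≢⇒∥u∥<∥v∥ (π u) (π v) (proj-⊑ d≤n u v u⊑v) (u≢v ∘ proj-injective u v u∈Λ v∈Λ)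

  -- A proper nonzero w ⊑ s would, moved by a permutation τ realising ‖orb(s)‖, have norm below every
  -- pending orbit norm, hence be reducible by G; moving the reducer back reduces s.
  irreducible-candidate-graver : ∀ {Gs C₁ s C₂} → Invariant ⟨ Gs , C₁ ++ s ∷ C₂ ⟩ →
    (∀ t → t ∈ C₁ ++ s ∷ C₂ → orbNorm d≤n S s ≤ orbNorm d≤n S t) →
    ¬ Reducible (orbAll S Gs) s → s ≢ zeroV → Graver B s
  irreducible-candidate-graver {Gs} {C₁} {s} inv s-min s-irr s≢0 = s∈Λ , s≢0 , minimal
    where
    s∈Λ : InLattice B s
    s∈Λ = Csym⊆Λ inv (∈-++⁺ʳ C₁ (here refl))
    minimal : ∀ w → InLattice B w → w ≢ zeroV → w ⊑ s → w ≡ s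
    minimal w w∈Λ w≢0 w⊑s = decidable-stable (w ≟ᵥ s) λ w≢s → reduce-s w≢s (orbNorm-attained s)
      where
      reduce-s : w ≢ s → (∃ λ τ → τ ∈ S × orbNorm d≤n S s ≡ ‖ act τ s ‖) → ⊥
      reduce-s w≢s (τ , τ∈S , orbNorm≡) with inverse∈S S grp τ∈S
      ... | ρ , ρ∈S , ρτ≗id , _ =
        reducible-below inv (s-min _) (S-preserves-Λ τ w τ∈S w∈Λ) (act-≢zeroV τ w≢0) τw<orbNorm
          λ (g , g∈G , g⊑τw) → s-irr (act ρ g , orbAll-closed S grp Gs ρ∈S g∈G ,
            ⊑-trans (act ρ g) w s (subst (act ρ g ⊑_) (ρτ≗id w) (act-⊑ ρ g (act τ w) g⊑τw)) w⊑s)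
        where
        τw<orbNorm : ‖ act τ w ‖ < orbNorm d≤n S s
        τw<orbNorm = subst (‖ act τ w ‖ <_) (sym orbNorm≡)
          (⊑∧≢⇒‖u‖<‖v‖ (S-preserves-Λ τ w τ∈S w∈Λ) (S-preserves-Λ τ s τ∈S s∈Λ) (act-⊑ τ w s w⊑s) (w≢s ∘ act-injective τ))

  invariant-init : ∀ {st} → Init S Fbar st → Invariant st
  invariant-init {⟨ Gs , C ⟩} ((reps⊆Fbar , Fbar-covered , _) , (reps⊆sums , sums-covered′ , _)) = record
    { G⊆Graver     = G⊆Graver′
    ; Fbar⊆G       = λ v∈F̄ → let r , r∈Gs , r~v = Fbar-covered _ v∈F̄ in ∈-orbAll⁺ S r∈Gs r~v
    ; Csym⊆Λ       = λ c∈C → let f , g , f∈G , g∈G , c≡f+g = All.lookup reps⊆sums c∈C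
                              in subst (InLattice B) (sym c≡f+g) (inLattice-+ᵥ B (proj₁ (G⊆Graver′ f∈G)) (proj₁ (G⊆Graver′ g∈G)))
    ; sums-covered = λ {f} {g} f∈G g∈G → inj₂ (inj₂ (sums-covered′ (f +ᵥ g) (f , g , f∈G , g∈G , refl)))
    }
    where
    G⊆Graver′ : ∀ {v} → v ∈ orbAll S Gs → Graver B v
    G⊆Graver′ v∈G with ∈-orbAll⁻ S Gs v∈G
    ... | r , r∈Gs , σ , σ∈S , refl = graver-act σ∈S (Fbar⊆Graver (All.lookup reps⊆Fbar r∈Gs))

  covered-by-removed : ∀ {Gs s f w σ} → σ ∈ S → NF (orbAll S Gs) s f → f ≡ zeroV → w ≡ act σ s →
    w ≡ zeroV ⊎ Reducible (orbAll S Gs) w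
  covered-by-removed {Gs} {s} {σ = σ} σ∈S (inj₁ ((g , g∈G , g⊑s) , _)) _ refl =
    inj₂ (act σ g , orbAll-closed S grp Gs σ∈S g∈G , act-⊑ σ g s g⊑s)
  covered-by-removed {σ = σ} σ∈S (inj₂ (_ , refl)) refl refl = inj₁ (act-zeroV σ)

  invariant-drop : ∀ {Gs C₁ s C₂ f} → Invariant ⟨ Gs , C₁ ++ s ∷ C₂ ⟩ →
    NF (orbAll S Gs) s f → f ≡ zeroV → Invariant ⟨ Gs , C₁ ++ C₂ ⟩
  invariant-drop {Gs} {C₁} {s} {C₂} inv nf f≡0 = record
    { G⊆Graver     = G⊆Graver inv
    ; Fbar⊆G       = Fbar⊆G inv
    ; Csym⊆Λ       = Csym⊆Λ inv ∘ ∈-middle⁺ C₁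
    ; sums-covered = covered
    }
    where
    covered : ∀ {f g} → f ∈ orbAll S Gs → g ∈ orbAll S Gs → Covered (orbAll S Gs) (C₁ ++ C₂) (f +ᵥ g)
    covered f∈G g∈G with sums-covered inv f∈G g∈G
    ... | inj₁ f+g≡0 = inj₁ f+g≡0
    ... | inj₂ (inj₁ f+g-red) = inj₂ (inj₁ f+g-red)
    ... | inj₂ (inj₂ (c , c∈C , σ , σ∈S , f+g≡σc)) with ∈-middle⁻ C₁ c∈C
    ...   | inj₁ refl = Sum.map₂ inj₁ (covered-by-removed {Gs} σ∈S nf f≡0 f+g≡σc)
    ...   | inj₂ c∈C′ = inj₂ (inj₂ (c , c∈C′ , σ , σ∈S , f+g≡σc))

  invariant-add : ∀ {Gs C₁ s C₂} → Invariant ⟨ Gs , C₁ ++ s ∷ C₂ ⟩ → Graver B s →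
    Invariant ⟨ Gs ++ s ∷ [] , C₁ ++ C₂ ++ L.map (s +ᵥ_) (orbAll S (Gs ++ s ∷ [])) ⟩
  invariant-add {Gs} {C₁} {s} {C₂} inv s-graver = record
    { G⊆Graver     = G⊆Graver′
    ; Fbar⊆G       = orbAll-++⁺ˡ S Gs (s ∷ []) ∘ Fbar⊆G inv
    ; Csym⊆Λ       = C⊆Λ
    ; sums-covered = covered
    }
    where
    G′ : List (Vec ℤ n)
    G′ = orbAll S (Gs ++ s ∷ [])
    C′ : List (Vec ℤ n)
    C′ = C₁ ++ C₂ ++ L.map (s +ᵥ_) G′
    G⊆Graver′ : ∀ {v} → v ∈ G′ → Graver B v
    G⊆Graver′ v∈G′ with orbAll-snoc⁻ S Gs s v∈G′
    ... | inj₁ v∈G             = G⊆Graver inv v∈G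
    ... | inj₂ (σ , σ∈S , refl) = graver-act σ∈S s-graver
    C⊆Λ : ∀ {c} → c ∈ C′ → InLattice B c
    C⊆Λ c∈C′ with ∈-++-++⁻ C₁ C₂ c∈C′
    ... | inj₁ c∈C = Csym⊆Λ inv (∈-middle⁺ C₁ c∈C)
    ... | inj₂ c∈s+G′ with ∈-map⁻ (s +ᵥ_) c∈s+G′
    ...   | g , g∈G′ , refl = inLattice-+ᵥ B (proj₁ s-graver) (proj₁ (G⊆Graver′ g∈G′))
    -- σ(s) + g = σ(s + σ⁻¹(g)), and s + σ⁻¹(g) has just been added to C.
    covered-σs+ : ∀ {σ g} → σ ∈ S → g ∈ G′ → Covered G′ C′ (act σ s +ᵥ g)
    covered-σs+ {σ} {g} σ∈S g∈G′ with inverse∈S S grp σ∈S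
    ... | ρ , ρ∈S , _ , σρ≗id = inj₂ (inj₂ (s +ᵥ act ρ g ,
      ∈-++⁺ʳ C₁ (∈-++⁺ʳ C₂ (∈-map⁺ (s +ᵥ_) (orbAll-closed S grp (Gs ++ s ∷ []) ρ∈S g∈G′))) ,
      σ , σ∈S , sym (trans (act-+ᵥ σ s (act ρ g)) (cong (act σ s +ᵥ_) (σρ≗id g)))))
    covered : ∀ {f g} → f ∈ G′ → g ∈ G′ → Covered G′ C′ (f +ᵥ g)
    covered {f} {g} f∈G′ g∈G′ with orbAll-snoc⁻ S Gs s f∈G′ | orbAll-snoc⁻ S Gs s g∈G′
    ... | inj₂ (σ , σ∈S , refl) | _                      = covered-σs+ σ∈S g∈G′
    ... | inj₁ _               | inj₂ (σ , σ∈S , refl)   = subst (Covered G′ C′) (+ᵥ-comm g f) (covered-σs+ σ∈S f∈G′)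
    ... | inj₁ f∈G             | inj₁ g∈G with sums-covered inv f∈G g∈G
    ...   | inj₁ f+g≡0                      = inj₁ f+g≡0
    ...   | inj₂ (inj₁ (h , h∈G , h⊑f+g))   = inj₂ (inj₁ (h , orbAll-++⁺ˡ S Gs (s ∷ []) h∈G , h⊑f+g))
    ...   | inj₂ (inj₂ (c , c∈C , σ , σ∈S , f+g≡σc)) with ∈-middle⁻ C₁ c∈C
    ...     | inj₁ refl = inj₂ (inj₁ (f +ᵥ g ,
                subst (_∈ G′) (sym f+g≡σc) (∈-orbAll⁺ S (∈-++⁺ʳ Gs (here refl)) (σ , σ∈S , refl)) , ⊑-refl (f +ᵥ g)))
    ...     | inj₂ c∈C′ = inj₂ (inj₂ (c , ∈-++-++⁺ˡ C₁ C₂ c∈C′ , σ , σ∈S , f+g≡σc))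

  invariant-step : ∀ {st st′} → Invariant st → Step d≤n S st st′ → Invariant st′
  invariant-step inv (drop Gs C₁ s C₂ f _ nf f≡0) = invariant-drop inv nf f≡0
  invariant-step inv (add Gs C₁ s C₂ f s-min nf f≢0) with NF-≢zeroV nf f≢0
  ... | refl , s-irr = invariant-add inv (irreducible-candidate-graver inv s-min s-irr f≢0)

  invariant-reachable : ∀ {st st′} → Star (Step d≤n S) st st′ → Invariant st → Invariant st′
  invariant-reachable ε              inv = inv
  invariant-reachable (step ◅ steps) inv = invariant-reachable steps (invariant-step inv step)

lemma14 : ∀ {n d} (d≤n : d ≤ n) (B : Vec (Vec ℤ n) d) (S : List (Permutation′ n)) (Fbar : Vec ℤ n → Set) →
    (∀ v w → InLattice B v → InLattice B w → proj d≤n v ≡ proj d≤n w → v ≡ w) →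
    IsPermGroup S →
    (∀ σ v → σ ∈ S → InLattice B v → InLattice B (act σ v)) →
    (∀ v → Fbar v → InLattice B v) →
    (∀ u → (Σ (Vec ℤ n) λ v → Fbar v × proj d≤n v ≡ u) ⇔ MinimalNonzero (InProjLattice d≤n B) u) →
    ∀ st → Init S Fbar st →
      Acc (λ t s → Step d≤n S s t) st ×
      (∀ st′ → Star (Step d≤n S) st st′ →
        (Csym st′ ≢ [] → Σ (State n) λ st″ → Step d≤n S st′ st″) ×
        (Csym st′ ≡ [] → ∀ v → (v ∈ orbAll S (Gsym st′)) ⇔ Graver B v))
lemma14 d≤n B S Fbar proj-injective grp S-preserves-Λ Fbar⊆Λ Fbar-minimal st init =
  step-wellFounded d≤n S grp st ,
  λ st′ st↝st′ → progress d≤n S st′ ,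
                 invariant⇒graver (invariant-reachable st↝st′ (invariant-init init))
  where
  open Algorithm d≤n B S Fbar proj-injective grp S-preserves-Λ Fbar⊆Λ Fbar-minimal
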